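{- Let $(x,z)$ be a half-integral, fully reduced, well-structured feasible solution to Forest-BCR for a Steiner Forest instance on a complete graph, and let $\hat G$ be its projection multigraph. Then for every support vertex $v$, at least one of the following holds: (i) there is a vertex $w\in V$ such that $\hat G$ contains two parallel edges $\{v,w\}$; (ii) either $v$ itself is a high-degree vertex, or one of its neighbors in $\hat G$ is a high-degree vertex. Moreover, every support vertex has degree at least two in $\hat G$.
   Context: A Steiner Forest instance $(G,c,\mathcal{P})$: $G=(V,E)$ a complete undirected graph, $c:E\to\mathbb{R}_{\ge0}$, $\mathcal{P}$ a collection of pairs $\{s,t\}\subseteq V$; terminals $R$ are the vertices in at least one pair. $\overrightarrow{E}$ replaces each $\{u,v\}\in E$ by $(u,v),(v,u)$; $\delta^+(U)$ is the set of directed edges leaving $U$. Forest-BCR: variables $x^r_e$, $z^r_P$ ($r\in V$, $e\in\overrightarrow{E}$, $P\in\mathcal{P}$); minimize $\sum_r\sum_e c(e)x^r_e$ s.t. $\sum_r z^r_P=1$ for all $P$; $\sum_{e\in\delta^+(U)}x^r_e\ge z^r_P$ for all $r$, $P$, $U\subseteq V\setminus\{r\}$ with $P\cap U\ne\emptyset$; $x,z\ge0$. A splitting-off step for root $r$, vertex $v$ and distinct $u,w\ne v$ decreases $x^r_{(u,v)},x^r_{(v,w)}$ by $\epsilon>0$ and increases $x^r_{(u,w)}$ by $\epsilon$. Well structured: (a) $z^r_P=0$ for $r\in V\setminus R$, and (b) no splitting-off step with $\epsilon>0$ preserves feasibility. Fully reduced: well structured and no single variable $x^r_e$ can be decreased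 by any $\epsilon>0$ while preserving feasibility. Half-integral: all entries are integer multiples of $\frac12$. The projection multigraph $\hat G=(V,\hat E)$ contains $2\sum_{r\in V}(x^r_{(v,w)}+x^r_{(w,v)})$ parallel copies of each edge $\{v,w\}$. A support vertex is a vertex with at least one incident edge in $\hat G$; a high-degree vertex has at least $3$ incident edges in $\hat G$. -}

module Defs where

open import Data.Nat using (ℕ; zero; suc)
open import Data.Fin using (Fin; zero; suc; _≟_)
open import Data.Fin.Subset using (Subset)
open import Data.Vec using (lookup)
open import Data.Bool using (Bool; true; false; if_then_else_; _∧_; not)
open import Data.Integer using (ℤ)
open import Data.Rational using (ℚ; 0ℚ; 1ℚ; _+_; _-_; _*_; _≤_; _<_; _/_)
open import Data.Product using (Σ; ∃; ∃-syntax; _×_; _,_; proj₁; proj₂)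
open import Data.Sum using (_⊎_)
open import Data.Empty using (⊥)
open import Relation.Nullary using (¬_; does)
open import Relation.Binary.PropositionalEquality using (_≡_; _≢_)
open import Function using (_∘_)

Σ[_] : (n : ℕ) → (Fin n → ℚ) → ℚ
Σ[ zero ] f = 0ℚ
Σ[ suc n ] f = f zero + Σ[ n ] (f ∘ suc)

2ℚ 3ℚ ½ : ℚ
2ℚ = 1ℚ + 1ℚ
3ℚ = 2ℚ + 1ℚ
½ = Data.Integer.+_ 1 / 2

[_] : Bool → ℚ
[ b ] = if b then 1ℚ else 0ℚ

_==_ : ∀ {n} → Fin n → Fin n → Bool
a == b = does (a ≟ b)

-- A Steiner Forest instance on the complete graph with vertex set Fin n
-- and k demand pairs {s,t} (s ≢ t).  Costs do not enter the constraints
-- and hence are irrelevant for the statement.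
record Instance (n k : ℕ) : Set where
  field
    pair     : Fin k → Fin n × Fin n
    pairDist : ∀ P → proj₁ (pair P) ≢ proj₂ (pair P)

open Instance public

IsTerminal : ∀ {n k} → Instance n k → Fin n → Set
IsTerminal I v = ∃[ P ] (v ≡ proj₁ (pair I P) ⊎ v ≡ proj₂ (pair I P))

-- x r u v : value of x^r_{(u,v)}  (only entries with u ≢ v are meaningful;
-- the diagonal is never used).  z r P : value of z^r_P.
XVar : ℕ → Set
XVar n = Fin n → Fin n → Fin n → ℚ

ZVar : ℕ → ℕ → Set
ZVar n k = Fin n → Fin k → ℚ

outSum : ∀ {n} → XVar n → Fin n → Subset n → ℚ
outSum {n} x r U =
  Σ[ n ] (λ a → Σ[ n ] (λ b → if lookup U a ∧ not (lookup U b) then x r a b else 0ℚ))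

_∈S_ : ∀ {n} → Fin n → Subset n → Set
a ∈S U = lookup U a ≡ true

Feasible : ∀ {n k} → Instance n k → XVar n → ZVar n k → Set
Feasible {n} {k} I x z =
    (∀ r a b → a ≢ b → 0ℚ ≤ x r a b)
  × (∀ r P → 0ℚ ≤ z r P)
  × (∀ P → Σ[ n ] (λ r → z r P) ≡ 1ℚ)
  × (∀ r P (U : Subset n) → ¬ (r ∈S U)
       → (proj₁ (pair I P) ∈S U ⊎ proj₂ (pair I P) ∈S U)
       → z r P ≤ outSum x r U)

HalfIntegral : ∀ {n k} → XVar n → ZVar n k → Set
HalfIntegral x z =
    (∀ r a b → a ≢ b → ∃[ m ] x r a b ≡ m / 2)
  × (∀ r P → ∃[ m ] z r P ≡ m / 2)

splitOff : ∀ {n} → XVar n → Fin n → Fin n → Fin n → Fin n → ℚ → XVar n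
splitOff x r v u w ε r' a b =
  x r' a b
  - ε * [ (r' == r) ∧ (a == u) ∧ (b == v) ]
  - ε * [ (r' == r) ∧ (a == v) ∧ (b == w) ]
  + ε * [ (r' == r) ∧ (a == u) ∧ (b == w) ]

decrease : ∀ {n} → XVar n → Fin n → Fin n → Fin n → ℚ → XVar n
decrease x r u v ε r' a b = x r' a b - ε * [ (r' == r) ∧ (a == u) ∧ (b == v) ]

WellStructured : ∀ {n k} → Instance n k → XVar n → ZVar n k → Set
WellStructured I x z =
    (∀ r P → ¬ IsTerminal I r → z r P ≡ 0ℚ)
  × (∀ r v u w ε → u ≢ v → w ≢ v → u ≢ w → 0ℚ < ε
       → ¬ Feasible I (splitOff x r v u w ε) z)

FullyReduced : ∀ {n k} → Instance n k → XVar n → ZVar n k → Set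
FullyReduced I x z =
    WellStructured I x z
  × (∀ r u v ε → u ≢ v → 0ℚ < ε → ¬ Feasible I (decrease x r u v ε) z)

-- number of parallel copies of edge {v,w} (v ≢ w) in the projection multigraph
mult : ∀ {n} → XVar n → Fin n → Fin n → ℚ
mult {n} x v w = 2ℚ * Σ[ n ] (λ r → x r v w + x r w v)

deg : ∀ {n} → XVar n → Fin n → ℚ
deg {n} x v = Σ[ n ] (λ w → if v == w then 0ℚ else mult x v w)

Adjacent : ∀ {n} → XVar n → Fin n → Fin n → Set
Adjacent x v w = v ≢ w × 0ℚ < mult x v w

SupportVertex : ∀ {n} → XVar n → Fin n → Set
SupportVertex x v = ∃[ w ] Adjacent x v w

HighDegree : ∀ {n} → XVar n → Fin n → Set
HighDegree x v = 3ℚ ≤ deg x v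

module Submission where

-- Half-integrality makes every positive variable at least ½, so if (i) and (ii) fail at v, then v and
-- each of its neighbours is "thin": it carries exactly two half-units of x, towards two distinct
-- neighbours. Full reducedness then forces an arc entering a thin vertex to be rooted at it, for
-- otherwise the variable could be lowered, the vertex could be split off, or (at a terminal) a family of
-- cuts, one per root, separating the roots from the demand pair would carry total value ½ < 1 = Σ_r z^r_P.
-- In each of the three possible configurations of the two arcs at v one of these obstructions occurs.
-- The same obstructions rule out a vertex carrying a single half-unit, which gives degree at least two.

open import Defs
open import Algebra using (CommutativeMonoid)
open import Data.Nat using (ℕ; zero; suc; s≤s; z≤n)
open import Data.Fin using (Fin; zero; suc; _≟_)
open import Data.Fin.Subset using (Subset)
open import Data.Fin.Properties using (any?)
open import Data.Vec using (lookup; tabulate)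
open import Data.Vec.Properties using (lookup∘tabulate)
open import Data.Bool using (Bool; true; false; if_then_else_; _∧_; _∨_; not)
open import Data.Bool.Properties
  using (not-¬; ¬-not; not-involutive; ∨-identityʳ; ∧-identityʳ; ∨-conicalˡ; ∨-conicalʳ; ∧-conicalˡ; ∧-conicalʳ)
open import Data.Integer as ℤ using (ℤ; -[1+_]; +≤+; -≤+)
import Data.Integer.Properties as ℤ
open import Data.Rational using (ℚ; 0ℚ; 1ℚ; _+_; _-_; _*_; _≤_; _<_; _/_; -_; *<*)
open import Data.Rational.Properties
  using (≤-refl; ≤-trans; ≤-reflexive; <⇒≤; <-irrefl; <-≤-trans; ≤-<-trans; <-trans; ≮⇒≥; ≰⇒>; ≤-antisym;
         _<?_; _≤?_; +-mono-≤; +-monoʳ-≤; +-monoˡ-≤; +-identityˡ; +-identityʳ; +-inverseʳ; +-assoc; +-comm;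
         *-monoˡ-≤-nonNeg; +-0-commutativeMonoid; toℚᵘ-cancel-≤; toℚᵘ-fromℚᵘ; module ≤-Reasoning)
open import Data.Rational.Solver using (module +-*-Solver)
import Data.Rational.Unnormalised as ℚᵘ
import Data.Rational.Unnormalised.Properties as ℚᵘ
open import Data.Product using (∃-syntax; _×_; _,_; proj₁; proj₂)
open import Data.Product.Properties using (≡-dec)
open import Data.Sum using (_⊎_; inj₁; inj₂; reduce)
open import Data.Empty using (⊥; ⊥-elim)
open import Function using (_∘_)
open import Relation.Nullary using (¬_; Dec; yes; no)
open import Relation.Nullary.Decidable using (dec-true; dec-false; _⊎-dec_; _×-dec_; ¬?)
open import Relation.Binary.PropositionalEquality
open import Algebra.Properties.CommutativeSemigroup
  (CommutativeMonoid.commutativeSemigroup +-0-commutativeMonoid) using (x∙yz≈y∙xz)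

==-refl : ∀ {n} (a : Fin n) → (a == a) ≡ true
==-refl a = dec-true (a ≟ a) refl

==-≢ : ∀ {n} {a b : Fin n} → a ≢ b → (a == b) ≡ false
==-≢ {a = a} {b} = dec-false (a ≟ b)

==⇒≡ : ∀ {n} {a b : Fin n} → (a == b) ≡ true → a ≡ b
==⇒≡ {a = a} {b} eq with a ≟ b
... | yes a≡b = a≡b

==⇒≢ : ∀ {n} {a b : Fin n} → (a == b) ≡ false → a ≢ b
==⇒≢ {a = a} {b} eq with a ≟ b
... | no a≢b = a≢b

not-true : ∀ {b} → not b ≡ true → b ≡ false
not-true {b} nb = trans (sym (not-involutive b)) (cong not nb)

IsHalfInteger : ℚ → Set
IsHalfInteger h = ∃[ m ] h ≡ m / 2

/2-mono-≤ : ∀ {m m′ : ℤ} → m ℤ.≤ m′ → m / 2 ≤ m′ / 2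
/2-mono-≤ {m} {m′} m≤m′ = toℚᵘ-cancel-≤
  (ℚᵘ.≤-respʳ-≃ (ℚᵘ.≃-sym (toℚᵘ-fromℚᵘ (ℚᵘ.mkℚᵘ m′ 1)))
    (ℚᵘ.≤-respˡ-≃ (ℚᵘ.≃-sym (toℚᵘ-fromℚᵘ (ℚᵘ.mkℚᵘ m 1)))
      (ℚᵘ.*≤* (ℤ.*-monoʳ-≤-nonNeg (ℤ.+ 2) m≤m′))))

0<½ : 0ℚ < ½
0<½ = *<* (ℤ.+<+ (s≤s z≤n))

½<1 : ½ < 1ℚ
½<1 = *<* (ℤ.+<+ (s≤s (s≤s z≤n)))

2<3 : 2ℚ < 3ℚ
2<3 = *<* (ℤ.+<+ (s≤s (s≤s (s≤s z≤n))))

0≤½ : 0ℚ ≤ ½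
0≤½ = <⇒≤ 0<½

half-integer-positive⇒½≤ : ∀ {h} → IsHalfInteger h → 0ℚ < h → ½ ≤ h
half-integer-positive⇒½≤ (ℤ.+ zero    , refl) 0<h = ⊥-elim (<-irrefl refl 0<h)
half-integer-positive⇒½≤ (ℤ.+ suc m   , refl) 0<h = /2-mono-≤ {ℤ.+ 1} {ℤ.+ suc m} (+≤+ (s≤s z≤n))
half-integer-positive⇒½≤ (-[1+ m ] , refl) 0<h = ⊥-elim (<-irrefl refl (<-≤-trans 0<h (/2-mono-≤ { -[1+ m ]} {ℤ.+ 0} -≤+)))

half-integer-<1⇒≤½ : ∀ {h} → IsHalfInteger h → h < 1ℚ → h ≤ ½
half-integer-<1⇒≤½ (ℤ.+ zero          , refl) h<1 = 0≤½
half-integer-<1⇒≤½ (ℤ.+ suc zero      , refl) h<1 = ≤-refl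
half-integer-<1⇒≤½ (ℤ.+ suc (suc m)   , refl) h<1 =
  ⊥-elim (<-irrefl refl (<-≤-trans h<1 (/2-mono-≤ {ℤ.+ 2} {ℤ.+ suc (suc m)} (+≤+ (s≤s (s≤s z≤n))))))
half-integer-<1⇒≤½ (-[1+ m ]        , refl) h<1 = /2-mono-≤ { -[1+ m ]} {ℤ.+ 1} -≤+

p≤q⇒0≤q-p : ∀ {p q} → p ≤ q → 0ℚ ≤ q - p
p≤q⇒0≤q-p {p} p≤q = ≤-trans (≤-reflexive (sym (+-inverseʳ p))) (+-monoˡ-≤ (- p) p≤q)

+-transfer : ∀ a b c → a + b ≡ (a - c) + (b + c)
+-transfer = solve 3 (λ a b c → a :+ b := (a :- c) :+ (b :+ c)) refl
  where open +-*-Solver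

p≤p+½ : ∀ p → p ≤ p + ½
p≤p+½ p = ≤-trans (≤-reflexive (sym (+-identityʳ p))) (+-monoʳ-≤ p 0≤½)

module _ {n : ℕ} where

  erase : Fin n → (Fin n → ℚ) → Fin n → ℚ
  erase i f j = if j == i then 0ℚ else f j

  erase-≢ : ∀ {i j} (f : Fin n → ℚ) → j ≢ i → erase i f j ≡ f j
  erase-≢ f j≢i rewrite ==-≢ j≢i = refl

  erase-nonneg : ∀ {f : Fin n → ℚ} → (∀ j → 0ℚ ≤ f j) → ∀ i j → 0ℚ ≤ erase i f j
  erase-nonneg 0≤f i j with j == i
  ... | true  = ≤-refl
  ... | false = 0≤f j

  erase-nonpos : ∀ {f : Fin n → ℚ} {i} → (∀ j → j ≢ i → f j ≤ 0ℚ) → ∀ j → erase i f j ≤ 0ℚ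
  erase-nonpos {i = i} f≤0 j with j == i in j=i
  ... | true  = ≤-refl
  ... | false = f≤0 j (==⇒≢ j=i)

  erase-mono : ∀ {j} {f g : Fin n → ℚ} b → (b ≢ j → f b ≤ g b) → erase j f b ≤ erase j g b
  erase-mono {j} b f≤g with b == j in b=j
  ... | true  = ≤-refl
  ... | false = f≤g (==⇒≢ b=j)

  erase₂ : Fin n × Fin n → (Fin n → Fin n → ℚ) → Fin n → Fin n → ℚ
  erase₂ (i , j) T a = if a == i then erase j (T a) else T a

  erase₂-mono : ∀ {i j} {T T′ : Fin n → Fin n → ℚ} a b → ((a , b) ≢ (i , j) → T a b ≤ T′ a b)
              → erase₂ (i , j) T a b ≤ erase₂ (i , j) T′ a b
  erase₂-mono {i} {T = T} {T′} a b T≤T′ with a == i in a=i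
  ... | true  = erase-mono {f = T a} {T′ a} b (λ b≢j → T≤T′ (λ e → b≢j (cong proj₂ e)))
  ... | false = T≤T′ (λ e → ==⇒≢ a=i (cong proj₁ e))

  erase₂-nonpos : ∀ {i j} {T : Fin n → Fin n → ℚ} → (∀ a b → (a , b) ≢ (i , j) → T a b ≤ 0ℚ)
                → ∀ a b → erase₂ (i , j) T a b ≤ 0ℚ
  erase₂-nonpos {i} T≤0 a b with a == i in a=i
  ... | true  = erase-nonpos (λ b b≢j → T≤0 a b (λ e → b≢j (cong proj₂ e))) b
  ... | false = T≤0 a b (λ e → ==⇒≢ a=i (cong proj₁ e))

  erase₂-≢ : ∀ {i j a b} (T : Fin n → Fin n → ℚ) → (a , b) ≢ (i , j) → erase₂ (i , j) T a b ≡ T a b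
  erase₂-≢ {i} {j} {a} {b} T ab≢ij with a == i in a=i
  ... | true  = erase-≢ (T a) (λ b≡j → ab≢ij (cong₂ _,_ (==⇒≡ a=i) b≡j))
  ... | false = refl

Σ-cong : ∀ {n} {f g : Fin n → ℚ} → (∀ i → f i ≡ g i) → Σ[ n ] f ≡ Σ[ n ] g
Σ-cong {zero}  f≡g = refl
Σ-cong {suc n} f≡g = cong₂ _+_ (f≡g zero) (Σ-cong (λ i → f≡g (suc i)))

Σ-mono-≤ : ∀ {n} {f g : Fin n → ℚ} → (∀ i → f i ≤ g i) → Σ[ n ] f ≤ Σ[ n ] g
Σ-mono-≤ {zero}  f≤g = ≤-refl
Σ-mono-≤ {suc n} f≤g = +-mono-≤ (f≤g zero) (Σ-mono-≤ (λ i → f≤g (suc i)))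

Σ-zero : ∀ n → Σ[ n ] (λ _ → 0ℚ) ≡ 0ℚ
Σ-zero zero    = refl
Σ-zero (suc n) = trans (+-identityˡ _) (Σ-zero n)

Σ-nonneg : ∀ {n} {f : Fin n → ℚ} → (∀ i → 0ℚ ≤ f i) → 0ℚ ≤ Σ[ n ] f
Σ-nonneg {n} 0≤f = ≤-trans (≤-reflexive (sym (Σ-zero n))) (Σ-mono-≤ 0≤f)

Σ-nonpos : ∀ {n} {f : Fin n → ℚ} → (∀ i → f i ≤ 0ℚ) → Σ[ n ] f ≤ 0ℚ
Σ-nonpos {n} f≤0 = ≤-trans (Σ-mono-≤ f≤0) (≤-reflexive (Σ-zero n))

Σ-erase : ∀ {n} (f : Fin n → ℚ) i → Σ[ n ] f ≡ f i + Σ[ n ] (erase i f)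
Σ-erase {suc n} f zero    = cong (f zero +_) (sym (+-identityˡ _))
Σ-erase {suc n} f (suc i) = trans (cong (f zero +_) (Σ-erase (λ j → f (suc j)) i))
                                  (x∙yz≈y∙xz (f zero) (f (suc i)) _)

term≤Σ : ∀ {n} {f : Fin n → ℚ} → (∀ i → 0ℚ ≤ f i) → ∀ i → f i ≤ Σ[ n ] f
term≤Σ {n} {f} 0≤f i = begin
  f i                        ≡⟨ sym (+-identityʳ (f i)) ⟩
  f i + 0ℚ                   ≤⟨ +-monoʳ-≤ (f i) (Σ-nonneg (erase-nonneg 0≤f i)) ⟩
  f i + Σ[ n ] (erase i f)   ≡⟨ sym (Σ-erase f i) ⟩
  Σ[ n ] f                   ∎
  where open ≤-Reasoning

Σ≤term : ∀ {n} {f : Fin n → ℚ} {i} → (∀ j → j ≢ i → f j ≤ 0ℚ) → Σ[ n ] f ≤ f i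
Σ≤term {n} {f} {i} f≤0 = begin
  Σ[ n ] f                   ≡⟨ Σ-erase f i ⟩
  f i + Σ[ n ] (erase i f)   ≤⟨ +-monoʳ-≤ (f i) (Σ-nonpos (erase-nonpos f≤0)) ⟩
  f i + 0ℚ                   ≡⟨ +-identityʳ (f i) ⟩
  f i                        ∎
  where open ≤-Reasoning

terms₂≤Σ : ∀ {n} {f : Fin n → ℚ} → (∀ i → 0ℚ ≤ f i) → ∀ {i j} → j ≢ i → f i + f j ≤ Σ[ n ] f
terms₂≤Σ {n} {f} 0≤f {i} {j} j≢i = begin
  f i + f j                  ≡⟨ cong (f i +_) (sym (erase-≢ f j≢i)) ⟩
  f i + erase i f j          ≤⟨ +-monoʳ-≤ (f i) (term≤Σ (erase-nonneg 0≤f i) j) ⟩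
  f i + Σ[ n ] (erase i f)   ≡⟨ sym (Σ-erase f i) ⟩
  Σ[ n ] f                   ∎
  where open ≤-Reasoning

terms₃≤Σ : ∀ {n} {f : Fin n → ℚ} → (∀ i → 0ℚ ≤ f i) → ∀ {i j l} → j ≢ i → l ≢ i → l ≢ j
         → f i + (f j + f l) ≤ Σ[ n ] f
terms₃≤Σ {n} {f} 0≤f {i} {j} {l} j≢i l≢i l≢j = begin
  f i + (f j + f l)                    ≡⟨ cong (f i +_) (sym (cong₂ _+_ (erase-≢ f j≢i) (erase-≢ f l≢i))) ⟩
  f i + (erase i f j + erase i f l)    ≤⟨ +-monoʳ-≤ (f i) (terms₂≤Σ (erase-nonneg 0≤f i) l≢j) ⟩
  f i + Σ[ n ] (erase i f)             ≡⟨ sym (Σ-erase f i) ⟩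
  Σ[ n ] f                             ∎
  where open ≤-Reasoning

Σ-positive⇒term-positive : ∀ {n} {f : Fin n → ℚ} → 0ℚ < Σ[ n ] f → ∃[ i ] 0ℚ < f i
Σ-positive⇒term-positive {f = f} 0<Σ with any? (λ i → 0ℚ <? f i)
... | yes found = found
... | no none = ⊥-elim (<-irrefl refl (<-≤-trans 0<Σ (Σ-nonpos (λ i → ≮⇒≥ (λ 0<fi → none (i , 0<fi))))))

ΣΣ : ∀ {n} → (Fin n → Fin n → ℚ) → ℚ
ΣΣ {n} T = Σ[ n ] (λ a → Σ[ n ] (T a))

ΣΣ-mono-≤ : ∀ {n} {T T′ : Fin n → Fin n → ℚ} → (∀ a b → T a b ≤ T′ a b) → ΣΣ T ≤ ΣΣ T′
ΣΣ-mono-≤ T≤T′ = Σ-mono-≤ (λ a → Σ-mono-≤ (T≤T′ a))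

ΣΣ-nonneg : ∀ {n} {T : Fin n → Fin n → ℚ} → (∀ a b → 0ℚ ≤ T a b) → 0ℚ ≤ ΣΣ T
ΣΣ-nonneg 0≤T = Σ-nonneg (λ a → Σ-nonneg (0≤T a))

ΣΣ-nonpos : ∀ {n} {T : Fin n → Fin n → ℚ} → (∀ a b → T a b ≤ 0ℚ) → ΣΣ T ≤ 0ℚ
ΣΣ-nonpos T≤0 = Σ-nonpos (λ a → Σ-nonpos (T≤0 a))

ΣΣ-erase : ∀ {n} (T : Fin n → Fin n → ℚ) i j → ΣΣ T ≡ T i j + ΣΣ (erase₂ (i , j) T)
ΣΣ-erase {n} T i j = begin
  ΣΣ T                                                  ≡⟨ Σ-erase R i ⟩
  R i + Σ[ n ] (erase i R)                              ≡⟨ cong (_+ Σ[ n ] (erase i R)) (Σ-erase (T i) j) ⟩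
  (T i j + Σ[ n ] (erase j (T i))) + Σ[ n ] (erase i R) ≡⟨ +-assoc (T i j) _ _ ⟩
  T i j + (Σ[ n ] (erase j (T i)) + Σ[ n ] (erase i R)) ≡⟨ cong (T i j +_) (cong₂ _+_ row-i other-rows) ⟩
  T i j + (S i + Σ[ n ] (erase i S))                    ≡⟨ cong (T i j +_) (sym (Σ-erase S i)) ⟩
  T i j + ΣΣ (erase₂ (i , j) T)                         ∎
  where
  open ≡-Reasoning
  R S : Fin n → ℚ
  R a = Σ[ n ] (T a)
  S a = Σ[ n ] (erase₂ (i , j) T a)
  row-i : Σ[ n ] (erase j (T i)) ≡ S i
  row-i rewrite ==-refl i = refl
  other-rows : Σ[ n ] (erase i R) ≡ Σ[ n ] (erase i S)
  other-rows = Σ-cong λ a → lemma a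
    where
    lemma : ∀ a → erase i R a ≡ erase i S a
    lemma a with a == i
    ... | true  = refl
    ... | false = refl

ΣΣ≤entry : ∀ {n} {T : Fin n → Fin n → ℚ} {i j} → (∀ a b → (a , b) ≢ (i , j) → T a b ≤ 0ℚ) → ΣΣ T ≤ T i j
ΣΣ≤entry {T = T} {i} {j} T≤0 = begin
  ΣΣ T                            ≡⟨ ΣΣ-erase T i j ⟩
  T i j + ΣΣ (erase₂ (i , j) T)   ≤⟨ +-monoʳ-≤ (T i j) (ΣΣ-nonpos (erase₂-nonpos T≤0)) ⟩
  T i j + 0ℚ                      ≡⟨ +-identityʳ (T i j) ⟩
  T i j                           ∎
  where open ≤-Reasoning

ΣΣ-exchange : ∀ {n} {T T′ : Fin n → Fin n → ℚ} {i j k l} → (k , l) ≢ (i , j)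
            → (∀ a b → (a , b) ≢ (i , j) → (a , b) ≢ (k , l) → T a b ≤ T′ a b)
            → T i j + T k l ≤ T′ i j + T′ k l → ΣΣ T ≤ ΣΣ T′
ΣΣ-exchange {T = T} {T′} {i} {j} {k} {l} kl≢ij T≤T′ sum≤ = begin
  ΣΣ T                    ≡⟨ expand T ⟩
  (T i j + T k l) + ΣΣ (rest T)      ≤⟨ +-mono-≤ sum≤ (ΣΣ-mono-≤ rest-mono) ⟩
  (T′ i j + T′ k l) + ΣΣ (rest T′)   ≡⟨ sym (expand T′) ⟩
  ΣΣ T′                   ∎
  where
  open ≤-Reasoning
  rest : (Fin _ → Fin _ → ℚ) → Fin _ → Fin _ → ℚ
  rest U = erase₂ (k , l) (erase₂ (i , j) U)
  rest-mono : ∀ a b → rest T a b ≤ rest T′ a b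
  rest-mono a b = erase₂-mono {T = erase₂ (i , j) T} {erase₂ (i , j) T′} a b
    (λ ab≢kl → erase₂-mono {T = T} {T′} a b (λ ab≢ij → T≤T′ a b ab≢ij ab≢kl))
  expand : ∀ U → ΣΣ U ≡ (U i j + U k l) + ΣΣ (rest U)
  expand U = trans (ΣΣ-erase U i j) (trans
    (cong (U i j +_) (trans (ΣΣ-erase (erase₂ (i , j) U) k l)
                            (cong (_+ ΣΣ (rest U)) (erase₂-≢ U kl≢ij))))
    (sym (+-assoc (U i j) (U k l) (ΣΣ (rest U)))))

-- Cuts

-- A cut is given by its characteristic function, so that outSum x r U is cutValue (x r) (lookup U) by definition.

Cut : ℕ → Set
Cut n = Fin n → Bool

crossing : ∀ {n} → (Fin n → Fin n → ℚ) → Cut n → Fin n → Fin n → ℚ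
crossing y χ a b = if χ a ∧ not (χ b) then y a b else 0ℚ

cutValue : ∀ {n} → (Fin n → Fin n → ℚ) → Cut n → ℚ
cutValue y χ = ΣΣ (crossing y χ)

module _ {n} {y : Fin n → Fin n → ℚ} {χ : Cut n} where

  crossing-≤ : ∀ a b {c} → 0ℚ ≤ c → (χ a ≡ true → χ b ≡ false → y a b ≤ c) → crossing y χ a b ≤ c
  crossing-≤ a b 0≤c y≤c with χ a | χ b
  ... | true  | false = y≤c refl refl
  ... | true  | true  = 0≤c
  ... | false | _     = 0≤c

  ≤-crossing : ∀ a b {c} → χ a ≡ true → χ b ≡ false → c ≤ y a b → c ≤ crossing y χ a b
  ≤-crossing a b a∈χ b∉χ c≤y rewrite a∈χ | b∉χ = c≤y

  crossing-nonneg : ∀ a b → (a ≢ b → 0ℚ ≤ y a b) → 0ℚ ≤ crossing y χ a b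
  crossing-nonneg a b 0≤y with χ a in a∈χ | χ b in b∉χ
  ... | true  | false = 0≤y (λ { refl → not-¬ a∈χ b∉χ })
  ... | true  | true  = ≤-refl
  ... | false | _     = ≤-refl

  crossing-cong : ∀ {y′} a b → (χ a ≡ true → χ b ≡ false → y a b ≡ y′ a b) → crossing y χ a b ≡ crossing y′ χ a b
  crossing-cong a b y≡y′ with χ a | χ b
  ... | true  | false = y≡y′ refl refl
  ... | true  | true  = refl
  ... | false | _     = refl

  cutValue-agree : ∀ {y′} → (∀ a b → χ a ≡ true → χ b ≡ false → y a b ≡ y′ a b) → cutValue y χ ≡ cutValue y′ χ
  cutValue-agree {y′} y≡y′ = Σ-cong (λ a → Σ-cong (λ b → crossing-cong {y′ = y′} a b (y≡y′ a b)))

  cutValue-nonneg : (∀ a b → a ≢ b → 0ℚ ≤ y a b) → 0ℚ ≤ cutValue y χ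
  cutValue-nonneg 0≤y = ΣΣ-nonneg (λ a b → crossing-nonneg a b (0≤y a b))

  cutValue≤0 : (∀ a b → χ a ≡ true → χ b ≡ false → y a b ≤ 0ℚ) → cutValue y χ ≤ 0ℚ
  cutValue≤0 y≤0 = ΣΣ-nonpos (λ a b → crossing-≤ a b ≤-refl (y≤0 a b))

  cutValue≤arc : ∀ {a₀ b₀ c} → 0ℚ ≤ c → y a₀ b₀ ≤ c
               → (∀ a b → χ a ≡ true → χ b ≡ false → (a , b) ≢ (a₀ , b₀) → y a b ≤ 0ℚ)
               → cutValue y χ ≤ c
  cutValue≤arc 0≤c y₀≤c y≤0 = ≤-trans
    (ΣΣ≤entry {T = crossing y χ} (λ a b ab≢ → crossing-≤ a b ≤-refl (λ a∈χ b∉χ → y≤0 a b a∈χ b∉χ ab≢)))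
    (crossing-≤ _ _ 0≤c (λ _ _ → y₀≤c))

cutValue-≤ : ∀ {n} {y y′ : Fin n → Fin n → ℚ} {χ χ′ : Cut n}
           → (∀ a b → 0ℚ ≤ crossing y′ χ′ a b)
           → (∀ a b → χ a ≡ true → χ b ≡ false → y a b ≤ crossing y′ χ′ a b)
           → cutValue y χ ≤ cutValue y′ χ′
cutValue-≤ {y = y} {χ = χ} 0≤y′ y≤y′ = ΣΣ-mono-≤ (λ a b → crossing-≤ {y = y} {χ} a b (0≤y′ a b) (y≤y′ a b))

member-≢ : ∀ {n} {χ : Cut n} {a b} → χ a ≡ true → χ b ≡ false → a ≢ b
member-≢ a∈χ b∉χ refl = not-¬ a∈χ b∉χ

crossing-≡ : ∀ {n} {y : Fin n → Fin n → ℚ} {χ : Cut n} {a b} → χ a ≡ true → χ b ≡ false → crossing y χ a b ≡ y a b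
crossing-≡ a∈χ b∉χ rewrite a∈χ | b∉χ = refl

noncrossing-≢ : ∀ {n} {χ : Cut n} {i j a b} → χ i ≡ false ⊎ χ j ≡ true → χ a ≡ true → χ b ≡ false
              → (a , b) ≢ (i , j)
noncrossing-≢ {χ = χ} (inj₁ i∉χ) a∈χ b∉χ refl = member-≢ {χ = χ} a∈χ i∉χ refl
noncrossing-≢ {χ = χ} (inj₂ j∈χ) a∈χ b∉χ refl = member-≢ {χ = χ} j∈χ b∉χ refl

cutValue-tabulate : ∀ {n} (y : Fin n → Fin n → ℚ) (χ : Cut n) → cutValue y (lookup (tabulate χ)) ≡ cutValue y χ
cutValue-tabulate y χ = Σ-cong (λ a → Σ-cong (λ b → cong₂ (λ s t → if s ∧ not t then y a b else 0ℚ)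
  (lookup∘tabulate χ a) (lookup∘tabulate χ b)))

module _ {n : ℕ} where

  ⁅_⁆ : Fin n → Cut n
  ⁅ u ⁆ a = a == u

  allBut : Fin n → Fin n → Cut n
  allBut u w a = not (a == u ∨ a == w)

  insert remove : Fin n → Cut n → Cut n
  insert u χ a = χ a ∨ a == u
  remove u χ a = χ a ∧ not (a == u)

  allBut-true : ∀ {u w a} → allBut u w a ≡ true → a ≢ u × a ≢ w
  allBut-true {u} {w} {a} a∈ with a == u in a=u | a == w in a=w
  ... | false | false = ==⇒≢ a=u , ==⇒≢ a=w

  allBut-false : ∀ {u w a} → allBut u w a ≡ false → a ≡ u ⊎ a ≡ w
  allBut-false {u} {w} {a} a∉ with a == u in a=u | a == w in a=w
  ... | true  | _    = inj₁ (==⇒≡ a=u)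
  ... | false | true = inj₂ (==⇒≡ a=w)

  allBut-≢ : ∀ {u w a} → a ≢ u → a ≢ w → allBut u w a ≡ true
  allBut-≢ a≢u a≢w rewrite ==-≢ a≢u | ==-≢ a≢w = refl

  allBut-excludes : ∀ u w → allBut u w u ≡ false
  allBut-excludes u w rewrite ==-refl u = refl

  insert-∌ : ∀ u (χ : Cut n) {a} → χ a ≡ false → a ≢ u → insert u χ a ≡ false
  insert-∌ u χ a∉χ a≢u rewrite a∉χ | ==-≢ a≢u = refl

  remove-∌ : ∀ u (χ : Cut n) {a} → χ a ≡ false → remove u χ a ≡ false
  remove-∌ u χ a∉χ rewrite a∉χ = refl

  insert-touches : ∀ u (χ : Cut n) {s t} → χ s ≡ true ⊎ χ t ≡ true → insert u χ s ≡ true ⊎ insert u χ t ≡ true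
  insert-touches u χ (inj₁ s∈χ) rewrite s∈χ = inj₁ refl
  insert-touches u χ (inj₂ t∈χ) rewrite t∈χ = inj₂ refl

  remove-touches : ∀ u (χ : Cut n) {s t} → s ≢ u → t ≢ u → χ s ≡ true ⊎ χ t ≡ true
                 → remove u χ s ≡ true ⊎ remove u χ t ≡ true
  remove-touches u χ s≢u t≢u (inj₁ s∈χ) rewrite s∈χ | ==-≢ s≢u = inj₁ refl
  remove-touches u χ s≢u t≢u (inj₂ t∈χ) rewrite t∈χ | ==-≢ t≢u = inj₂ refl

module _ {n} (y y′ : Fin n → Fin n → ℚ) (u : Fin n) (χ : Cut n) (0≤y′ : ∀ a b → 0ℚ ≤ crossing y′ χ a b) where

  -- moving u into the cut only loses arcs into u and only gains arcs out of u
  cutValue-insert : (∀ b → χ b ≡ false → b ≢ u → y u b ≤ 0ℚ)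
                  → (∀ a b → χ a ≡ true → χ b ≡ false → b ≢ u → y a b ≤ y′ a b)
                  → cutValue y (insert u χ) ≤ cutValue y′ χ
  cutValue-insert out≤0 y≤y′ = cutValue-≤ {y = y} {y′} {insert u χ} {χ} 0≤y′ compare
    where
    compare : ∀ a b → insert u χ a ≡ true → insert u χ b ≡ false → y a b ≤ crossing y′ χ a b
    compare a b a∈ b∉ with a ≟ u
    ... | yes refl = ≤-trans (out≤0 b b∉χ b≢u) (0≤y′ a b)
      where
      b∉χ = ∨-conicalˡ (χ b) (b == u) b∉
      b≢u = ==⇒≢ (∨-conicalʳ (χ b) (b == u) b∉)
    ... | no a≢u   = ≤-crossing {y = y′} {χ} a b a∈χ b∉χ (y≤y′ a b a∈χ b∉χ b≢u)
      where
      a∈χ = trans (sym (∨-identityʳ (χ a))) a∈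
      b∉χ = ∨-conicalˡ (χ b) (b == u) b∉
      b≢u = ==⇒≢ (∨-conicalʳ (χ b) (b == u) b∉)

  cutValue-remove : (∀ a → χ a ≡ true → a ≢ u → y a u ≤ 0ℚ)
                  → (∀ a b → χ a ≡ true → χ b ≡ false → a ≢ u → y a b ≤ y′ a b)
                  → cutValue y (remove u χ) ≤ cutValue y′ χ
  cutValue-remove in≤0 y≤y′ = cutValue-≤ {y = y} {y′} {remove u χ} {χ} 0≤y′ compare
    where
    compare : ∀ a b → remove u χ a ≡ true → remove u χ b ≡ false → y a b ≤ crossing y′ χ a b
    compare a b a∈ b∉ with b ≟ u
    ... | yes refl = ≤-trans (in≤0 a a∈χ a≢u) (0≤y′ a b)
      where
      a∈χ = ∧-conicalˡ (χ a) (not (a == u)) a∈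
      a≢u = ==⇒≢ (not-true (∧-conicalʳ (χ a) (not (a == u)) a∈))
    ... | no b≢u   = ≤-crossing {y = y′} {χ} a b a∈χ b∉χ (y≤y′ a b a∈χ b∉χ a≢u)
      where
      a∈χ = ∧-conicalˡ (χ a) (not (a == u)) a∈
      a≢u = ==⇒≢ (not-true (∧-conicalʳ (χ a) (not (a == u)) a∈))
      b∉χ = trans (sym (∧-identityʳ (χ b))) b∉

module Solution {n k : ℕ} (I : Instance n k) (x : XVar n) (z : ZVar n k)
  (feasible : Feasible I x z) (half : HalfIntegral x z) (reduced : FullyReduced I x z) where

  -- (root, tail, head)
  RootedArc : Set
  RootedArc = Fin n × Fin n × Fin n

  xAt : RootedArc → ℚ
  xAt (r , a , b) = x r a b

  x-nonneg : ∀ r a b → a ≢ b → 0ℚ ≤ x r a b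
  x-nonneg = proj₁ feasible

  x-positive⇒½≤ : ∀ r a b → a ≢ b → 0ℚ < x r a b → ½ ≤ x r a b
  x-positive⇒½≤ r a b a≢b = half-integer-positive⇒½≤ (proj₁ half r a b a≢b)

  x-<1⇒≤½ : ∀ r a b → a ≢ b → x r a b < 1ℚ → x r a b ≤ ½
  x-<1⇒≤½ r a b a≢b = half-integer-<1⇒≤½ (proj₁ half r a b a≢b)

  Touches : Fin k → Cut n → Set
  Touches P χ = χ (proj₁ (pair I P)) ≡ true ⊎ χ (proj₂ (pair I P)) ≡ true

  Partner : Fin k → Fin n → Fin n → Set
  Partner P u t = (u ≡ proj₁ (pair I P) × t ≡ proj₂ (pair I P))
                ⊎ (u ≡ proj₂ (pair I P) × t ≡ proj₁ (pair I P))

  terminal⇒partner : ∀ {u} → IsTerminal I u → ∃[ P ] ∃[ t ] Partner P u t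
  terminal⇒partner (P , inj₁ u≡s) = P , _ , inj₁ (u≡s , refl)
  terminal⇒partner (P , inj₂ u≡t) = P , _ , inj₂ (u≡t , refl)

  partner-≢ : ∀ {P u t} → Partner P u t → t ≢ u
  partner-≢ {P} (inj₁ (refl , refl)) t≡u = pairDist I P (sym t≡u)
  partner-≢ {P} (inj₂ (refl , refl)) t≡u = pairDist I P t≡u

  partner-touches : ∀ {P u t} {χ : Cut n} → Partner P u t → χ u ≡ true ⊎ χ t ≡ true → Touches P χ
  partner-touches (inj₁ (refl , refl)) u∨t = u∨t
  partner-touches (inj₂ (refl , refl)) (inj₁ u∈χ) = inj₂ u∈χ
  partner-touches (inj₂ (refl , refl)) (inj₂ t∈χ) = inj₁ t∈χ

  cut-constraint : ∀ r P (χ : Cut n) → χ r ≡ false → Touches P χ → z r P ≤ cutValue (x r) χ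
  cut-constraint r P χ r∉χ touches = subst (z r P ≤_) (cutValue-tabulate (x r) χ)
    (proj₂ (proj₂ (proj₂ feasible)) r P (tabulate χ) r∉U (subst-touches touches))
    where
    r∉U : ¬ (r ∈S tabulate χ)
    r∉U r∈U = not-¬ (trans (sym (lookup∘tabulate χ r)) r∈U) r∉χ
    subst-touches : Touches P χ → Touches P (lookup (tabulate χ))
    subst-touches (inj₁ s∈χ) = inj₁ (trans (lookup∘tabulate χ _) s∈χ)
    subst-touches (inj₂ t∈χ) = inj₂ (trans (lookup∘tabulate χ _) t∈χ)

  light-family-impossible : ∀ P (C : Fin n → Cut n) → (∀ r → C r r ≡ false) → (∀ r → Touches P (C r))
    → ∀ τ₀ → xAt τ₀ ≤ ½
    → (∀ r a b → C r a ≡ true → C r b ≡ false → (r , a , b) ≢ τ₀ → x r a b ≤ 0ℚ) → ⊥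
  light-family-impossible P C r∉C touches (r₀ , a₀ , b₀) x₀≤½ x≤0 = <-irrefl refl (begin-strict
    1ℚ                                   ≡⟨ sym (proj₁ (proj₂ (proj₂ feasible)) P) ⟩
    Σ[ n ] (λ r → z r P)                 ≤⟨ Σ-mono-≤ (λ r → cut-constraint r P (C r) (r∉C r) (touches r)) ⟩
    Σ[ n ] (λ r → cutValue (x r) (C r))  ≤⟨ Σ≤term other-roots ⟩
    cutValue (x r₀) (C r₀)               ≤⟨ cutValue≤arc 0≤½ x₀≤½ other-arcs ⟩
    ½                                    <⟨ ½<1 ⟩
    1ℚ                                   ∎)
    where
    open ≤-Reasoning
    other-roots : ∀ r → r ≢ r₀ → cutValue (x r) (C r) ≤ 0ℚ
    other-roots r r≢r₀ = cutValue≤0 (λ a b a∈ b∉ → x≤0 r a b a∈ b∉ (λ e → r≢r₀ (cong proj₁ e)))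
    other-arcs : ∀ a b → C r₀ a ≡ true → C r₀ b ≡ false → (a , b) ≢ (a₀ , b₀) → x r₀ a b ≤ 0ℚ
    other-arcs a b a∈ b∉ ab≢ = x≤0 r₀ a b a∈ b∉ (λ e → ab≢ (cong proj₂ e))

  module _ {P u t} (partner : Partner P u t) (A : Cut n) (A∌u : A u ≡ false) (A∋t : A t ≡ true)
    (s : Fin n) (t≢s : t ≢ s) where

    starCuts : Fin n → Cut n
    starCuts r = if r == u then A else if r == s then allBut s u else ⁅ u ⁆

    starCuts-excludes-root : ∀ r → starCuts r r ≡ false
    starCuts-excludes-root r with r ≟ u | r ≟ s
    ... | yes refl | _        = A∌u
    ... | no r≢u   | yes refl = allBut-excludes s u
    ... | no r≢u   | no _     = ==-≢ r≢u

    starCuts-touches : ∀ r → Touches P (starCuts r)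
    starCuts-touches r with r ≟ u | r ≟ s
    ... | yes _ | _     = partner-touches partner (inj₂ A∋t)
    ... | no _  | yes _ = partner-touches {χ = allBut s u} partner (inj₂ (allBut-≢ t≢s (partner-≢ partner)))
    ... | no _  | no _  = partner-touches {χ = ⁅ u ⁆} partner (inj₁ (==-refl u))

    light-star₂-impossible : ∀ τ₀ → xAt τ₀ ≤ ½
      → (∀ a b → A a ≡ true → A b ≡ false → (u , a , b) ≢ τ₀ → x u a b ≤ 0ℚ)
      → (s ≢ u → ∀ a b → a ≢ s → a ≢ u → b ≡ s ⊎ b ≡ u → x s a b ≤ 0ℚ)
      → (∀ r b → r ≢ u → r ≢ s → b ≢ u → (r , u , b) ≢ τ₀ → x r u b ≤ 0ℚ)
      → ⊥
    light-star₂-impossible τ₀ x₀≤½ root-u root-s other-roots =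
      light-family-impossible P starCuts starCuts-excludes-root starCuts-touches τ₀ x₀≤½ bound
      where
      bound : ∀ r a b → starCuts r a ≡ true → starCuts r b ≡ false → (r , a , b) ≢ τ₀ → x r a b ≤ 0ℚ
      bound r a b a∈ b∉ ≢τ₀ with r ≟ u | r ≟ s
      ... | yes refl | _        = root-u a b a∈ b∉ ≢τ₀
      ... | no r≢u   | yes refl =
        root-s r≢u a b (proj₁ (allBut-true a∈)) (proj₂ (allBut-true a∈)) (allBut-false b∉)
      ... | no r≢u   | no r≢s with refl ← ==⇒≡ {a = a} {u} a∈ = other-roots r b r≢u r≢s (==⇒≢ b∉) ≢τ₀

  light-star₁-impossible : ∀ {P u t} → Partner P u t → (A : Cut n) → A u ≡ false → A t ≡ true
    → ∀ τ₀ → xAt τ₀ ≤ ½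
    → (∀ a b → A a ≡ true → A b ≡ false → (u , a , b) ≢ τ₀ → x u a b ≤ 0ℚ)
    → (∀ r b → r ≢ u → b ≢ u → (r , u , b) ≢ τ₀ → x r u b ≤ 0ℚ)
    → ⊥
  light-star₁-impossible {u = u} partner A A∌u A∋t τ₀ x₀≤½ root-u other-roots =
    light-star₂-impossible partner A A∌u A∋t u (partner-≢ partner) τ₀ x₀≤½ root-u (λ u≢u → ⊥-elim (u≢u refl))
      (λ r b r≢u _ → other-roots r b r≢u)

  -- the mass on arcs into u rooted at u and on arcs out of u rooted elsewhere is at least 1
  light-terminal-impossible : ∀ {u} → IsTerminal I u → ∀ τ₀ → xAt τ₀ ≤ ½
    → (∀ a → a ≢ u → (u , a , u) ≢ τ₀ → x u a u ≤ 0ℚ)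
    → (∀ r b → r ≢ u → b ≢ u → (r , u , b) ≢ τ₀ → x r u b ≤ 0ℚ)
    → ⊥
  light-terminal-impossible {u} terminal τ₀ x₀≤½ in≤0 out≤0 with terminal⇒partner terminal
  ... | P , t , partner =
    light-star₁-impossible partner (allBut u u) (allBut-excludes u u) (allBut-≢ t≢u t≢u) τ₀ x₀≤½ root-u out≤0
    where
    t≢u = partner-≢ partner
    root-u : ∀ a b → allBut u u a ≡ true → allBut u u b ≡ false → (u , a , b) ≢ τ₀ → x u a b ≤ 0ℚ
    root-u a b a∈ b∉ ≢τ₀ with refl ← reduce (allBut-false {u = u} {u} {b} b∉) = in≤0 a (proj₁ (allBut-true a∈)) ≢τ₀

  -- Reductions

  terminal? : ∀ u → Dec (IsTerminal I u)
  terminal? u = any? (λ P → (u ≟ proj₁ (pair I P)) ⊎-dec (u ≟ proj₂ (pair I P)))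

  _≟ₜ_ : (τ σ : RootedArc) → Dec (τ ≡ σ)
  _≟ₜ_ = ≡-dec _≟_ (≡-dec _≟_ _≟_)

  match : RootedArc → RootedArc → Bool
  match (r , a , b) (ρ , p , u) = (r == ρ) ∧ (a == p) ∧ (b == u)

  match-≢ : ∀ {τ σ} → τ ≢ σ → match τ σ ≡ false
  match-≢ {r , a , b} {ρ , p , u} τ≢σ with r ≟ ρ | a ≟ p | b ≟ u
  ... | yes refl | yes refl | yes refl = ⊥-elim (τ≢σ refl)
  ... | yes _    | yes _    | no _     = refl
  ... | yes _    | no _     | _        = refl
  ... | no _     | _        | _        = refl

  match-refl : ∀ τ → match τ τ ≡ true
  match-refl (r , a , b) rewrite ==-refl r | ==-refl a | ==-refl b = refl

  feasible-after-change-at-root : ∀ (y : XVar n) ρ → (∀ r a b → r ≢ ρ → y r a b ≡ x r a b)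
    → (∀ r a b → a ≢ b → 0ℚ ≤ y r a b)
    → (∀ P (χ : Cut n) → χ ρ ≡ false → Touches P χ → z ρ P ≤ cutValue (y ρ) χ)
    → Feasible I y z
  feasible-after-change-at-root y ρ y≡x 0≤y cuts-ρ =
    0≤y , proj₁ (proj₂ feasible) , proj₁ (proj₂ (proj₂ feasible)) , cuts
    where
    cuts : ∀ r P (U : Subset n) → ¬ (r ∈S U) → Touches P (lookup U) → z r P ≤ outSum y r U
    cuts r P U r∉U touches with r ≟ ρ
    ... | yes refl = cuts-ρ P (lookup U) (¬-not r∉U) touches
    ... | no r≢ρ   = ≤-trans (proj₂ (proj₂ (proj₂ feasible)) r P U r∉U touches)
                       (≤-reflexive (cutValue-agree {y = x r} {lookup U} (λ a b _ _ → sym (y≡x r a b r≢ρ))))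

  module Decrease (ρ p u : Fin n) where

    lowered : XVar n
    lowered = decrease x ρ p u ½

    lowered-≢ : ∀ {r a b} → (r , a , b) ≢ (ρ , p , u) → lowered r a b ≡ x r a b
    lowered-≢ ne rewrite match-≢ ne = +-identityʳ _

    lowered-at : lowered ρ p u ≡ x ρ p u - ½
    lowered-at rewrite match-refl (ρ , p , u) = refl

    lowered-unchanged : ∀ χ → χ p ≡ false ⊎ χ u ≡ true → cutValue (x ρ) χ ≡ cutValue (lowered ρ) χ
    lowered-unchanged χ pu = cutValue-agree {y = x ρ} {χ}
      (λ a b a∈ b∉ → sym (lowered-≢ (noncrossing-≢ {χ = χ} pu a∈ b∉ ∘ cong proj₂)))

    module _ (p≢u : p ≢ u) (½≤x : ½ ≤ x ρ p u) where

      lowered-nonneg : ∀ r a b → a ≢ b → 0ℚ ≤ lowered r a b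
      lowered-nonneg r a b a≢b with (r , a , b) ≟ₜ (ρ , p , u)
      ... | yes refl = subst (0ℚ ≤_) (sym lowered-at) (p≤q⇒0≤q-p ½≤x)
      ... | no ne    = subst (0ℚ ≤_) (sym (lowered-≢ ne)) (x-nonneg r a b a≢b)

      lowered-crossing-nonneg : ∀ χ a b → 0ℚ ≤ crossing (lowered ρ) χ a b
      lowered-crossing-nonneg χ a b = crossing-nonneg {y = lowered ρ} {χ} a b (lowered-nonneg ρ a b)

      -- only the cuts crossed by (p, u) can be violated when x^ρ_(p,u) drops by ½
      decrease-impossible : (∀ P χ → χ ρ ≡ false → Touches P χ → χ p ≡ true → χ u ≡ false
                              → z ρ P ≤ cutValue (lowered ρ) χ) → ⊥
      decrease-impossible cuts = proj₂ reduced ρ p u ½ p≢u 0<½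
        (feasible-after-change-at-root lowered ρ (λ r a b r≢ρ → lowered-≢ (r≢ρ ∘ cong proj₁)) lowered-nonneg cuts-ρ)
        where
        cuts-ρ : ∀ P χ → χ ρ ≡ false → Touches P χ → z ρ P ≤ cutValue (lowered ρ) χ
        cuts-ρ P χ ρ∉χ touches with χ p in χp | χ u in χu
        ... | true  | false = cuts P χ ρ∉χ touches χp χu
        ... | false | _     = ≤-trans (cut-constraint ρ P χ ρ∉χ touches) (≤-reflexive (lowered-unchanged χ (inj₁ χp)))
        ... | true  | true  = ≤-trans (cut-constraint ρ P χ ρ∉χ touches) (≤-reflexive (lowered-unchanged χ (inj₂ χu)))

  no-arc-out-of-root : ∀ r q → r ≢ q → ¬ (0ℚ < x r r q)
  no-arc-out-of-root r q r≢q 0<x = decrease-impossible r≢q (x-positive⇒½≤ r r q r≢q 0<x)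
    (λ P χ r∉χ _ r∈χ _ → ⊥-elim (not-¬ r∈χ r∉χ))
    where open Decrease r r q

  positive⇒root-terminal : ∀ r a b → a ≢ b → 0ℚ < x r a b → IsTerminal I r
  positive⇒root-terminal r a b a≢b 0<x with terminal? r
  ... | yes terminal = terminal
  ... | no ¬terminal = ⊥-elim (decrease-impossible a≢b ½≤x (λ P χ _ _ _ _ →
          ≤-trans (≤-reflexive (proj₁ (proj₁ reduced) r P ¬terminal)) (cutValue-nonneg {y = lowered r} {χ} (lowered-nonneg a≢b ½≤x r))))
    where
    open Decrease r a b
    ½≤x = x-positive⇒½≤ r a b a≢b 0<x

  no-dead-end : ∀ ρ p u → ρ ≢ u → p ≢ u → ½ ≤ x ρ p u → (∀ c → c ≢ u → x ρ u c ≤ 0ℚ) → ⊥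
  no-dead-end ρ p u ρ≢u p≢u ½≤x out≤0 = decrease-impossible p≢u ½≤x λ P χ ρ∉χ touches _ _ →
    ≤-trans (cut-constraint ρ P (insert u χ) (insert-∌ u χ ρ∉χ ρ≢u) (insert-touches u χ touches))
            (cutValue-insert (x ρ) (lowered ρ) u χ (lowered-crossing-nonneg p≢u ½≤x χ) (λ b _ b≢u → out≤0 b b≢u)
               (λ a b _ _ b≢u → ≤-reflexive (sym (lowered-≢ (b≢u ∘ cong (proj₂ ∘ proj₂))))))
    where open Decrease ρ p u

  nonterminal-endpoints : ∀ {u} → ¬ IsTerminal I u → ∀ P → proj₁ (pair I P) ≢ u × proj₂ (pair I P) ≢ u
  nonterminal-endpoints ¬terminal P = (λ e → ¬terminal (P , inj₁ (sym e))) , (λ e → ¬terminal (P , inj₂ (sym e)))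

  no-nonterminal-source : ∀ ρ u q → ρ ≢ u → u ≢ q → ½ ≤ x ρ u q → (∀ c → c ≢ u → x ρ c u ≤ 0ℚ)
                        → ¬ IsTerminal I u → ⊥
  no-nonterminal-source ρ u q ρ≢u u≢q ½≤x in≤0 ¬terminal = decrease-impossible u≢q ½≤x λ P χ ρ∉χ touches _ _ →
    ≤-trans (cut-constraint ρ P (remove u χ) (remove-∌ u χ ρ∉χ)
               (remove-touches u χ (proj₁ (nonterminal-endpoints ¬terminal P)) (proj₂ (nonterminal-endpoints ¬terminal P)) touches))
            (cutValue-remove (x ρ) (lowered ρ) u χ (lowered-crossing-nonneg u≢q ½≤x χ) (λ a _ a≢u → in≤0 a a≢u)
               (λ a b _ _ a≢u → ≤-reflexive (sym (lowered-≢ (a≢u ∘ cong (proj₁ ∘ proj₂))))))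
    where open Decrease ρ u q

  module SplitOff (ρ p u q : Fin n) (p≢u : p ≢ u) (q≢u : q ≢ u) (p≢q : p ≢ q)
    (½≤x-pu : ½ ≤ x ρ p u) (½≤x-uq : ½ ≤ x ρ u q) where

    split : XVar n
    split = splitOff x ρ u p q ½

    split-≢ : ∀ {r a b} → (r , a , b) ≢ (ρ , p , u) → (r , a , b) ≢ (ρ , u , q) → (r , a , b) ≢ (ρ , p , q)
            → split r a b ≡ x r a b
    split-≢ ≢pu ≢uq ≢pq rewrite match-≢ ≢pu | match-≢ ≢uq | match-≢ ≢pq =
      trans (+-identityʳ _) (trans (+-identityʳ _) (+-identityʳ _))

    split-pu : split ρ p u ≡ x ρ p u - ½
    split-pu rewrite match-refl (ρ , p , u) | match-≢ {ρ , p , u} {ρ , u , q} (p≢u ∘ cong (proj₁ ∘ proj₂))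
                   | match-≢ {ρ , p , u} {ρ , p , q} (q≢u ∘ sym ∘ cong (proj₂ ∘ proj₂)) =
      trans (+-identityʳ (x ρ p u - ½ + 0ℚ)) (+-identityʳ (x ρ p u - ½))

    split-uq : split ρ u q ≡ x ρ u q - ½
    split-uq rewrite match-≢ {ρ , u , q} {ρ , p , u} (p≢u ∘ sym ∘ cong (proj₁ ∘ proj₂)) | match-refl (ρ , u , q)
                   | match-≢ {ρ , u , q} {ρ , p , q} (p≢u ∘ sym ∘ cong (proj₁ ∘ proj₂)) =
      trans (+-identityʳ (x ρ u q + 0ℚ - ½)) (cong (_- ½) (+-identityʳ (x ρ u q)))

    split-pq : split ρ p q ≡ x ρ p q + ½
    split-pq rewrite match-≢ {ρ , p , q} {ρ , p , u} (q≢u ∘ cong (proj₂ ∘ proj₂))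
                   | match-≢ {ρ , p , q} {ρ , u , q} (p≢u ∘ cong (proj₁ ∘ proj₂)) | match-refl (ρ , p , q) =
      cong (_+ ½) (trans (+-identityʳ (x ρ p q + 0ℚ)) (+-identityʳ (x ρ p q)))

    split-nonneg : ∀ r a b → a ≢ b → 0ℚ ≤ split r a b
    split-nonneg r a b a≢b with (r , a , b) ≟ₜ (ρ , p , u) | (r , a , b) ≟ₜ (ρ , u , q) | (r , a , b) ≟ₜ (ρ , p , q)
    ... | yes refl | _        | _        = subst (0ℚ ≤_) (sym split-pu) (p≤q⇒0≤q-p ½≤x-pu)
    ... | no _     | yes refl | _        = subst (0ℚ ≤_) (sym split-uq) (p≤q⇒0≤q-p ½≤x-uq)
    ... | no _     | no _     | yes refl = subst (0ℚ ≤_) (sym split-pq) (≤-trans (x-nonneg ρ p q p≢q) (p≤p+½ _))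
    ... | no ≢pu   | no ≢uq   | no ≢pq   = subst (0ℚ ≤_) (sym (split-≢ ≢pu ≢uq ≢pq)) (x-nonneg r a b a≢b)

    split-crossing-nonneg : ∀ χ a b → 0ℚ ≤ crossing (split ρ) χ a b
    split-crossing-nonneg χ a b = crossing-nonneg {y = split ρ} {χ} a b (split-nonneg ρ a b)

    cutValue-exchange : ∀ χ i j → (i , j) ≢ (p , q) → χ i ≡ true → χ j ≡ false → χ p ≡ true → χ q ≡ false
      → split ρ i j ≡ x ρ i j - ½
      → (∀ a b → χ a ≡ true → χ b ≡ false → (a , b) ≢ (i , j) → (a , b) ≢ (p , q) → split ρ a b ≡ x ρ a b)
      → cutValue (x ρ) χ ≤ cutValue (split ρ) χ
    cutValue-exchange χ i j ij≢pq i∈ j∉ p∈ q∉ split-ij agree =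
      ΣΣ-exchange {T = crossing (x ρ) χ} {crossing (split ρ) χ} (ij≢pq ∘ sym)
        (λ a b ≢ij ≢pq → ≤-reflexive (crossing-cong {y = x ρ} {χ} {split ρ} a b (λ a∈ b∉ → sym (agree a b a∈ b∉ ≢ij ≢pq))))
        (≤-reflexive sums)
      where
      open ≡-Reasoning
      sums : crossing (x ρ) χ i j + crossing (x ρ) χ p q ≡ crossing (split ρ) χ i j + crossing (split ρ) χ p q
      sums = begin
        crossing (x ρ) χ i j + crossing (x ρ) χ p q         ≡⟨ cong₂ _+_ (crossing-≡ {y = x ρ} i∈ j∉) (crossing-≡ {y = x ρ} p∈ q∉) ⟩
        x ρ i j + x ρ p q                                   ≡⟨ +-transfer (x ρ i j) (x ρ p q) ½ ⟩
        (x ρ i j - ½) + (x ρ p q + ½)                       ≡⟨ sym (cong₂ _+_ split-ij split-pq) ⟩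
        split ρ i j + split ρ p q                           ≡⟨ sym (cong₂ _+_ (crossing-≡ {y = split ρ} i∈ j∉) (crossing-≡ {y = split ρ} p∈ q∉)) ⟩
        crossing (split ρ) χ i j + crossing (split ρ) χ p q ∎

    module _ (ρ≢u : ρ ≢ u) (in≤0 : ∀ c → c ≢ u → c ≢ p → x ρ c u ≤ 0ℚ) (out≤0 : ∀ c → c ≢ u → c ≢ q → x ρ u c ≤ 0ℚ)
      (¬terminal : ¬ IsTerminal I u) where

      cut-bound-if-p∉ : ∀ P χ → χ ρ ≡ false → Touches P χ → χ p ≡ false → z ρ P ≤ cutValue (split ρ) χ
      cut-bound-if-p∉ P χ ρ∉χ touches p∉χ = ≤-trans
        (cut-constraint ρ P (remove u χ) (remove-∌ u χ ρ∉χ)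
          (remove-touches u χ (proj₁ (nonterminal-endpoints ¬terminal P)) (proj₂ (nonterminal-endpoints ¬terminal P)) touches))
        (cutValue-remove (x ρ) (split ρ) u χ (split-crossing-nonneg χ) (λ a a∈ a≢u → in≤0 a a≢u (a≢p a∈))
          (λ a b a∈ _ a≢u → ≤-reflexive (sym (split-≢ (a≢p a∈ ∘ cong (proj₁ ∘ proj₂)) (a≢u ∘ cong (proj₁ ∘ proj₂))
                                                      (a≢p a∈ ∘ cong (proj₁ ∘ proj₂))))))
        where
        a≢p : ∀ {a} → χ a ≡ true → a ≢ p
        a≢p a∈ = member-≢ {χ = χ} a∈ p∉χ

      cut-bound-if-q∈ : ∀ P χ → χ ρ ≡ false → Touches P χ → χ q ≡ true → z ρ P ≤ cutValue (split ρ) χ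
      cut-bound-if-q∈ P χ ρ∉χ touches q∈χ = ≤-trans
        (cut-constraint ρ P (insert u χ) (insert-∌ u χ ρ∉χ ρ≢u) (insert-touches u χ touches))
        (cutValue-insert (x ρ) (split ρ) u χ (split-crossing-nonneg χ) (λ b b∉ b≢u → out≤0 b b≢u (b≢q b∉))
          (λ a b _ b∉ b≢u → ≤-reflexive (sym (split-≢ (b≢u ∘ cong (proj₂ ∘ proj₂)) (b≢q b∉ ∘ cong (proj₂ ∘ proj₂))
                                                      (b≢q b∉ ∘ cong (proj₂ ∘ proj₂))))))
        where
        b≢q : ∀ {b} → χ b ≡ false → b ≢ q
        b≢q b∉ = member-≢ {χ = χ} q∈χ b∉ ∘ sym

      -- If p ∉ χ (q ∈ χ) then u is moved out of (into) χ; otherwise p ∈ χ ∌ q and the lowered arc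
      -- crossing χ is compensated by the raised arc (p, q).
      no-nonterminal-pass-through : ⊥
      no-nonterminal-pass-through = proj₂ (proj₁ reduced) ρ u p q ½ p≢u q≢u p≢q 0<½
        (feasible-after-change-at-root split ρ (λ r a b r≢ρ → split-≢ (r≢ρ ∘ cong proj₁) (r≢ρ ∘ cong proj₁) (r≢ρ ∘ cong proj₁))
           split-nonneg cuts-ρ)
        where
        cuts-ρ : ∀ P χ → χ ρ ≡ false → Touches P χ → z ρ P ≤ cutValue (split ρ) χ
        cuts-ρ P χ ρ∉χ touches with χ p in χp | χ q in χq | χ u in χu
        ... | false | _     | _     = cut-bound-if-p∉ P χ ρ∉χ touches χp
        ... | true  | true  | _     = cut-bound-if-q∈ P χ ρ∉χ touches χq
        ... | true  | false | false = ≤-trans (cut-constraint ρ P χ ρ∉χ touches)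
          (cutValue-exchange χ p u (q≢u ∘ sym ∘ cong proj₂) χp χu χp χq split-pu
            (λ a b a∈ b∉ ≢pu ≢pq → split-≢ (≢pu ∘ cong proj₂) (noncrossing-≢ {χ = χ} (inj₁ χu) a∈ b∉ ∘ cong proj₂)
                                           (≢pq ∘ cong proj₂)))
        ... | true  | false | true  = ≤-trans (cut-constraint ρ P χ ρ∉χ touches)
          (cutValue-exchange χ u q (p≢u ∘ sym ∘ cong proj₁) χu χq χp χq split-uq
            (λ a b a∈ b∉ ≢uq ≢pq → split-≢ (noncrossing-≢ {χ = χ} (inj₂ χu) a∈ b∉ ∘ cong proj₂) (≢uq ∘ cong proj₂)
                                           (≢pq ∘ cong proj₂)))

  data Dir : Set where
    outgoing incoming : Dir

  _≟ᵈ_ : (d d′ : Dir) → Dec (d ≡ d′)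
  outgoing ≟ᵈ outgoing = yes refl
  outgoing ≟ᵈ incoming = no λ ()
  incoming ≟ᵈ outgoing = no λ ()
  incoming ≟ᵈ incoming = yes refl

  flip : Dir → Dir
  flip outgoing = incoming
  flip incoming = outgoing

  -- (root, neighbour, direction): the variable x^root on the arc between the vertex and its neighbour
  Entry : Set
  Entry = Fin n × Fin n × Dir

  _≟ₑ_ : (e e′ : Entry) → Dec (e ≡ e′)
  _≟ₑ_ = ≡-dec _≟_ (≡-dec _≟_ _≟ᵈ_)

  nbr : Entry → Fin n
  nbr (_ , c , _) = c

  arc : Fin n → Entry → RootedArc
  arc u (r , c , outgoing) = r , u , c
  arc u (r , c , incoming) = r , c , u

  value : Fin n → Entry → ℚ
  value u e = xAt (arc u e)

  value-positive⇒½≤ : ∀ u e → nbr e ≢ u → 0ℚ < value u e → ½ ≤ value u e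
  value-positive⇒½≤ u (r , c , outgoing) c≢u = x-positive⇒½≤ r u c (c≢u ∘ sym)
  value-positive⇒½≤ u (r , c , incoming) c≢u = x-positive⇒½≤ r c u c≢u

  value-<1⇒≤½ : ∀ u e → nbr e ≢ u → value u e < 1ℚ → value u e ≤ ½
  value-<1⇒≤½ u (r , c , outgoing) c≢u = x-<1⇒≤½ r u c (c≢u ∘ sym)
  value-<1⇒≤½ u (r , c , incoming) c≢u = x-<1⇒≤½ r c u c≢u

  Positive : Fin n → Entry → Set
  Positive u e = nbr e ≢ u × 0ℚ < value u e

  arcMass : Fin n → Fin n → Fin n → ℚ
  arcMass u c r = x r u c + x r c u

  arcMass-nonneg : ∀ u c → c ≢ u → ∀ r → 0ℚ ≤ arcMass u c r
  arcMass-nonneg u c c≢u r = +-mono-≤ (x-nonneg r u c (c≢u ∘ sym)) (x-nonneg r c u c≢u)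

  value≤arcMass : ∀ u r c d → c ≢ u → value u (r , c , d) ≤ arcMass u c r
  value≤arcMass u r c outgoing c≢u = ≤-trans (≤-reflexive (sym (+-identityʳ _))) (+-monoʳ-≤ (x r u c) (x-nonneg r c u c≢u))
  value≤arcMass u r c incoming c≢u = ≤-trans (≤-reflexive (sym (+-identityˡ _))) (+-monoˡ-≤ (x r c u) (x-nonneg r u c (c≢u ∘ sym)))

  2*-mono-≤ : ∀ {a b} → a ≤ b → 2ℚ * a ≤ 2ℚ * b
  2*-mono-≤ = *-monoˡ-≤-nonNeg 2ℚ

  ½≤value⇒1≤mult : ∀ u e → nbr e ≢ u → ½ ≤ value u e → 1ℚ ≤ mult x u (nbr e)
  ½≤value⇒1≤mult u (r , c , d) c≢u ½≤v =
    2*-mono-≤ (≤-trans ½≤v (≤-trans (value≤arcMass u r c d c≢u) (term≤Σ (arcMass-nonneg u c c≢u) r)))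

  1≤value⇒2≤mult : ∀ u e → nbr e ≢ u → 1ℚ ≤ value u e → 2ℚ ≤ mult x u (nbr e)
  1≤value⇒2≤mult u (r , c , d) c≢u 1≤v =
    2*-mono-≤ (≤-trans 1≤v (≤-trans (value≤arcMass u r c d c≢u) (term≤Σ (arcMass-nonneg u c c≢u) r)))

  two-entries⇒2≤mult : ∀ u e e′ → nbr e ≢ u → nbr e′ ≡ nbr e → e′ ≢ e → ½ ≤ value u e → ½ ≤ value u e′
                     → 2ℚ ≤ mult x u (nbr e)
  two-entries⇒2≤mult u (r , c , d) (r′ , .c , d′) c≢u refl e′≢e ½≤v ½≤v′ with r′ ≟ r
  ... | no r′≢r = 2*-mono-≤ (≤-trans
          (+-mono-≤ (≤-trans ½≤v (value≤arcMass u r c d c≢u)) (≤-trans ½≤v′ (value≤arcMass u r′ c d′ c≢u)))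
          (terms₂≤Σ (arcMass-nonneg u c c≢u) r′≢r))
  ... | yes refl = 2*-mono-≤ (≤-trans (both-directions d d′ ½≤v ½≤v′ e′≢e) (term≤Σ (arcMass-nonneg u c c≢u) r))
    where
    both-directions : ∀ δ δ′ → ½ ≤ value u (r , c , δ) → ½ ≤ value u (r , c , δ′) → (r , c , δ′) ≢ (r , c , δ)
                    → 1ℚ ≤ arcMass u c r
    both-directions outgoing outgoing _ _  ne = ⊥-elim (ne refl)
    both-directions incoming incoming _ _  ne = ⊥-elim (ne refl)
    both-directions outgoing incoming h h′ _  = +-mono-≤ h h′
    both-directions incoming outgoing h h′ _  = +-mono-≤ h′ h

  mult<2⇒value<1 : ∀ u e → nbr e ≢ u → mult x u (nbr e) < 2ℚ → value u e < 1ℚ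
  mult<2⇒value<1 u e c≢u m<2 = ≰⇒> (λ 1≤v → <-irrefl refl (<-≤-trans m<2 (1≤value⇒2≤mult u e c≢u 1≤v)))

  positive-value≡½ : ∀ u e → Positive u e → mult x u (nbr e) < 2ℚ → value u e ≡ ½
  positive-value≡½ u e (c≢u , 0<v) m<2 =
    ≤-antisym (value-<1⇒≤½ u e c≢u (mult<2⇒value<1 u e c≢u m<2)) (value-positive⇒½≤ u e c≢u 0<v)

  unique-positive-entry : ∀ u e e′ → mult x u (nbr e) < 2ℚ → Positive u e → Positive u e′ → nbr e′ ≡ nbr e → e′ ≡ e
  unique-positive-entry u e e′ m<2 (c≢u , 0<v) (_ , 0<v′) same with e′ ≟ₑ e
  ... | yes e′≡e = e′≡e
  ... | no e′≢e  = ⊥-elim (<-irrefl refl (<-≤-trans m<2 (two-entries⇒2≤mult u e e′ c≢u same e′≢e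
                     (value-positive⇒½≤ u e c≢u 0<v) (value-positive⇒½≤ u e′ (subst (_≢ u) (sym same) c≢u) 0<v′))))

  degTerm : Fin n → Fin n → ℚ
  degTerm u w = if u == w then 0ℚ else mult x u w

  mult-nonneg : ∀ u c → c ≢ u → 0ℚ ≤ mult x u c
  mult-nonneg u c c≢u = 2*-mono-≤ (Σ-nonneg (arcMass-nonneg u c c≢u))

  degTerm-nonneg : ∀ u w → 0ℚ ≤ degTerm u w
  degTerm-nonneg u w with u ≟ w
  ... | yes _   = ≤-refl
  ... | no u≢w  = mult-nonneg u w (u≢w ∘ sym)

  degTerm-≢ : ∀ u c → c ≢ u → degTerm u c ≡ mult x u c
  degTerm-≢ u c c≢u rewrite ==-≢ (c≢u ∘ sym) = refl

  mult≤deg : ∀ u c → c ≢ u → mult x u c ≤ deg x u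
  mult≤deg u c c≢u = subst (_≤ deg x u) (degTerm-≢ u c c≢u) (term≤Σ (degTerm-nonneg u) c)

  mults₂≤deg : ∀ u c c′ → c ≢ u → c′ ≢ u → c′ ≢ c → mult x u c + mult x u c′ ≤ deg x u
  mults₂≤deg u c c′ c≢u c′≢u c′≢c =
    subst (_≤ deg x u) (cong₂ _+_ (degTerm-≢ u c c≢u) (degTerm-≢ u c′ c′≢u)) (terms₂≤Σ (degTerm-nonneg u) c′≢c)

  mults₃≤deg : ∀ u c c′ c″ → c ≢ u → c′ ≢ u → c″ ≢ u → c′ ≢ c → c″ ≢ c → c″ ≢ c′
             → mult x u c + (mult x u c′ + mult x u c″) ≤ deg x u
  mults₃≤deg u c c′ c″ c≢u c′≢u c″≢u c′≢c c″≢c c″≢c′ =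
    subst (_≤ deg x u) (cong₂ _+_ (degTerm-≢ u c c≢u) (cong₂ _+_ (degTerm-≢ u c′ c′≢u) (degTerm-≢ u c″ c″≢u)))
      (terms₃≤Σ (degTerm-nonneg u) c′≢c c″≢c c″≢c′)

  positive⇒1≤mult : ∀ u e → Positive u e → 1ℚ ≤ mult x u (nbr e)
  positive⇒1≤mult u e (c≢u , 0<v) = ½≤value⇒1≤mult u e c≢u (value-positive⇒½≤ u e c≢u 0<v)

  mult-sym : ∀ u c → mult x u c ≡ mult x c u
  mult-sym u c = cong (2ℚ *_) (Σ-cong (λ r → +-comm (x r u c) (x r c u)))

  -- Vertices with one or two entries

  record Single (u : Fin n) (e₁ : Entry) : Set where
    field
      nbr₁≢u : nbr e₁ ≢ u
      value₁ : value u e₁ ≡ ½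
      others : ∀ e → nbr e ≢ u → e ≢ e₁ → value u e ≤ 0ℚ

  record Thin (u : Fin n) (e₁ e₂ : Entry) : Set where
    field
      nbr₁≢u    : nbr e₁ ≢ u
      nbr₂≢u    : nbr e₂ ≢ u
      nbr₂≢nbr₁ : nbr e₂ ≢ nbr e₁
      value₁    : value u e₁ ≡ ½
      value₂    : value u e₂ ≡ ½
      others    : ∀ e → nbr e ≢ u → e ≢ e₁ → e ≢ e₂ → value u e ≤ 0ℚ

  ThinWith : Fin n → Entry → Set
  ThinWith u e₁ = ∃[ e₂ ] Thin u e₁ e₂

  thin-swap : ∀ {u e₁ e₂} → Thin u e₁ e₂ → Thin u e₂ e₁
  thin-swap th = record
    { nbr₁≢u = nbr₂≢u ; nbr₂≢u = nbr₁≢u ; nbr₂≢nbr₁ = nbr₂≢nbr₁ ∘ sym ; value₁ = value₂ ; value₂ = value₁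
    ; others = λ e e≢u e≢e₁ e≢e₂ → others e e≢u e≢e₂ e≢e₁ }
    where open Thin th

  positive? : ∀ u e → Dec (Positive u e)
  positive? u e = ¬? (nbr e ≟ u) ×-dec (0ℚ <? value u e)

  entry-any? : {Q : Entry → Set} → (∀ e → Dec (Q e)) → Dec (∃[ e ] Q e)
  entry-any? {Q} Q? with any? (λ r → any? (λ c → Q? (r , c , outgoing) ⊎-dec Q? (r , c , incoming)))
  ... | yes (r , c , inj₁ q) = yes ((r , c , outgoing) , q)
  ... | yes (r , c , inj₂ q) = yes ((r , c , incoming) , q)
  ... | no none = no λ { ((r , c , outgoing) , q) → none (r , c , inj₁ q) ; ((r , c , incoming) , q) → none (r , c , inj₂ q) }

  single-or-thin : ∀ u e₁ → Positive u e₁ → mult x u (nbr e₁) < 2ℚ → deg x u < 3ℚ → Single u e₁ ⊎ ThinWith u e₁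
  single-or-thin u e₁ pos₁@(c₁≢u , _) m₁<2 deg<3
    with entry-any? (λ e → positive? u e ×-dec ¬? (nbr e ≟ nbr e₁))
  ... | no none = inj₁ record { nbr₁≢u = c₁≢u ; value₁ = positive-value≡½ u e₁ pos₁ m₁<2 ; others = others }
    where
    others : ∀ e → nbr e ≢ u → e ≢ e₁ → value u e ≤ 0ℚ
    others e c≢u e≢e₁ with 0ℚ <? value u e | nbr e ≟ nbr e₁
    ... | no ¬pos | _         = ≮⇒≥ ¬pos
    ... | yes pos | yes same  = ⊥-elim (e≢e₁ (unique-positive-entry u e₁ e m₁<2 pos₁ (c≢u , pos) same))
    ... | yes pos | no other  = ⊥-elim (none (e , (c≢u , pos) , other))
  ... | yes (e₂ , pos₂@(c₂≢u , _) , c₂≢c₁) = inj₂ (e₂ , record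
    { nbr₁≢u = c₁≢u ; nbr₂≢u = c₂≢u ; nbr₂≢nbr₁ = c₂≢c₁
    ; value₁ = positive-value≡½ u e₁ pos₁ m₁<2 ; value₂ = positive-value≡½ u e₂ pos₂ m₂<2 ; others = others })
    where
    1≤m₁ = positive⇒1≤mult u e₁ pos₁
    m₂<2 : mult x u (nbr e₂) < 2ℚ
    m₂<2 = ≰⇒> λ 2≤m₂ → <-irrefl refl (<-≤-trans deg<3 (≤-trans (+-mono-≤ 1≤m₁ 2≤m₂) (mults₂≤deg u _ _ c₁≢u c₂≢u c₂≢c₁)))
    others : ∀ e → nbr e ≢ u → e ≢ e₁ → e ≢ e₂ → value u e ≤ 0ℚ
    others e c≢u e≢e₁ e≢e₂ with 0ℚ <? value u e | nbr e ≟ nbr e₁ | nbr e ≟ nbr e₂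
    ... | no ¬pos | _      | _      = ≮⇒≥ ¬pos
    ... | yes pos | yes c₁ | _      = ⊥-elim (e≢e₁ (unique-positive-entry u e₁ e m₁<2 pos₁ (c≢u , pos) c₁))
    ... | yes pos | no _   | yes c₂ = ⊥-elim (e≢e₂ (unique-positive-entry u e₂ e m₂<2 pos₂ (c≢u , pos) c₂))
    ... | yes pos | no ≢c₁ | no ≢c₂ = ⊥-elim (<-irrefl refl (<-≤-trans deg<3 (≤-trans
          (+-mono-≤ 1≤m₁ (+-mono-≤ (positive⇒1≤mult u e₂ pos₂) (positive⇒1≤mult u e (c≢u , pos))))
          (mults₃≤deg u _ _ _ c₁≢u c₂≢u c≢u c₂≢c₁ ≢c₁ ≢c₂))))

  ½-positive : ∀ {v} → v ≡ ½ → 0ℚ < v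
  ½-positive refl = 0<½

  no-single-entry : ∀ {u} e₁ → Single u e₁ → ⊥
  no-single-entry {u} (r₁ , c₁ , incoming) s with r₁ ≟ u
  ... | no r₁≢u  = no-dead-end r₁ c₁ u r₁≢u nbr₁≢u (≤-reflexive (sym value₁))
                     (λ c c≢u → others (r₁ , c , outgoing) c≢u λ ())
    where open Single s
  ... | yes refl = light-terminal-impossible (positive⇒root-terminal u c₁ u nbr₁≢u (½-positive value₁)) (u , c₁ , u)
                     (≤-reflexive value₁)
                     (λ a a≢u ≢τ₀ → others (u , a , incoming) a≢u (≢τ₀ ∘ cong (arc u)))
                     (λ r b _ b≢u _ → others (r , b , outgoing) b≢u λ ())
    where open Single s
  no-single-entry {u} (r₁ , c₁ , outgoing) s with r₁ ≟ u
  ... | yes refl = no-arc-out-of-root u c₁ (nbr₁≢u ∘ sym) (½-positive value₁)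
    where open Single s
  ... | no r₁≢u  = no-nonterminal-source r₁ u c₁ r₁≢u (nbr₁≢u ∘ sym) (≤-reflexive (sym value₁))
                     (λ c c≢u → others (r₁ , c , incoming) c≢u λ ())
                     (λ terminal → light-terminal-impossible terminal (r₁ , u , c₁) (≤-reflexive value₁)
                        (λ a a≢u _ → others (u , a , incoming) a≢u λ ())
                        (λ r b _ b≢u ≢τ₀ → others (r , b , outgoing) b≢u (≢τ₀ ∘ cong (arc u))))
    where open Single s

  positive-mult⇒entry : ∀ u c → c ≢ u → 0ℚ < mult x u c → ∃[ e ] (Positive u e × nbr e ≡ c)
  positive-mult⇒entry u c c≢u 0<m with Σ-positive⇒term-positive {f = arcMass u c} 0<Σ
    where
    0<Σ : 0ℚ < Σ[ n ] (arcMass u c)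
    0<Σ = ≰⇒> λ Σ≤0 → <-irrefl refl (<-≤-trans 0<m (2*-mono-≤ Σ≤0))
  ... | r , 0<mass with 0ℚ <? x r u c | 0ℚ <? x r c u
  ...   | yes 0<out | _        = (r , c , outgoing) , (c≢u , 0<out) , refl
  ...   | no _      | yes 0<in = (r , c , incoming) , (c≢u , 0<in) , refl
  ...   | no ¬out   | no ¬in   = ⊥-elim (<-irrefl refl (<-≤-trans 0<mass (+-mono-≤ (≮⇒≥ ¬out) (≮⇒≥ ¬in))))

  thin⇒2≤deg : ∀ {u e₁ e₂} → Thin u e₁ e₂ → 2ℚ ≤ deg x u
  thin⇒2≤deg {u} {e₁} {e₂} th = ≤-trans
    (+-mono-≤ (½≤value⇒1≤mult u e₁ nbr₁≢u (≤-reflexive (sym value₁))) (½≤value⇒1≤mult u e₂ nbr₂≢u (≤-reflexive (sym value₂))))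
    (mults₂≤deg u _ _ nbr₁≢u nbr₂≢u nbr₂≢nbr₁)
    where open Thin th

  degree≥2 : ∀ v → SupportVertex x v → 2ℚ ≤ deg x v
  degree≥2 v (w , v≢w , 0<m) with 2ℚ ≤? deg x v | positive-mult⇒entry v w (v≢w ∘ sym) 0<m
  ... | yes 2≤deg | _ = 2≤deg
  ... | no ¬2≤deg | e₁ , pos₁ , refl
    with single-or-thin v e₁ pos₁ (≤-<-trans (mult≤deg v w (v≢w ∘ sym)) (≰⇒> ¬2≤deg)) (<-trans (≰⇒> ¬2≤deg) 2<3)
  ...   | inj₁ single   = ⊥-elim (no-single-entry e₁ single)
  ...   | inj₂ (_ , th) = ⊥-elim (¬2≤deg (thin⇒2≤deg th))

  incoming-root : ∀ {u r₁ c₁ e₂} → Thin u (r₁ , c₁ , incoming) e₂ → r₁ ≡ u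
  incoming-root {u} {r₁} {c₁} {r₂ , c₂ , outgoing} th with r₁ ≟ u | r₂ ≟ r₁
  ... | yes r₁≡u | _        = r₁≡u
  ... | no r₁≢u  | yes refl = ⊥-elim (SplitOff.no-nonterminal-pass-through r₁ c₁ u c₂ nbr₁≢u nbr₂≢u (nbr₂≢nbr₁ ∘ sym)
      (≤-reflexive (sym value₁)) (≤-reflexive (sym value₂)) r₁≢u
      (λ c c≢u c≢c₁ → others (r₁ , c , incoming) c≢u (c≢c₁ ∘ cong nbr) λ ())
      (λ c c≢u c≢c₂ → others (r₁ , c , outgoing) c≢u (λ ()) (c≢c₂ ∘ cong nbr))
      (λ terminal → light-terminal-impossible terminal (r₁ , u , c₂) (≤-reflexive value₂)
         (λ a a≢u _ → others (u , a , incoming) a≢u (r₁≢u ∘ sym ∘ cong proj₁) λ ())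
         (λ r b _ b≢u ≢τ₀ → others (r , b , outgoing) b≢u (λ ()) (≢τ₀ ∘ cong (arc u)))))
    where open Thin th
  ... | no r₁≢u  | no r₂≢r₁ = ⊥-elim (no-dead-end r₁ c₁ u r₁≢u nbr₁≢u (≤-reflexive (sym value₁))
      (λ c c≢u → others (r₁ , c , outgoing) c≢u (λ ()) (r₂≢r₁ ∘ sym ∘ cong proj₁)))
    where open Thin th
  incoming-root {u} {r₁} {c₁} {r₂ , c₂ , incoming} th with r₁ ≟ u
  ... | yes r₁≡u = r₁≡u
  ... | no r₁≢u  = ⊥-elim (no-dead-end r₁ c₁ u r₁≢u nbr₁≢u (≤-reflexive (sym value₁))
      (λ c c≢u → others (r₁ , c , outgoing) c≢u (λ ()) (λ ())))
    where open Thin th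

  incoming-vanish : ∀ {u e₁ e₂} → Thin u e₁ e₂ → ∀ r c → r ≢ u → c ≢ u → x r c u ≤ 0ℚ
  incoming-vanish {u} {e₁} {e₂} th r c r≢u c≢u with (r , c , incoming) ≟ₑ e₁ | (r , c , incoming) ≟ₑ e₂
  ... | yes refl | _        = ⊥-elim (r≢u (incoming-root th))
  ... | no _     | yes refl = ⊥-elim (r≢u (incoming-root (thin-swap th)))
  ... | no ≢e₁   | no ≢e₂   = Thin.others th (r , c , incoming) c≢u ≢e₁ ≢e₂

  module _ {P u t p e₂} (th : Thin u (u , p , incoming) e₂) (partner : Partner P u t) where
    open Thin th

    -- root u uses the cut V ∖ {u, p}, which only the other entry of u crosses
    no-thin-terminal-beside-in-neighbour : t ≢ p → (∀ c → c ≢ p → x u c p ≤ 0ℚ) → ⊥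
    no-thin-terminal-beside-in-neighbour t≢p into-p≤0 =
      light-star₁-impossible partner (allBut u p) (allBut-excludes u p) (allBut-≢ (partner-≢ partner) t≢p)
        (arc u e₂) (≤-reflexive value₂) root-u
        (λ r b _ b≢u ≢τ₀ → others (r , b , outgoing) b≢u (λ ()) (≢τ₀ ∘ cong (arc u)))
      where
      root-u : ∀ a b → allBut u p a ≡ true → allBut u p b ≡ false → (u , a , b) ≢ arc u e₂ → x u a b ≤ 0ℚ
      root-u a b a∈ b∉ ≢τ₀ with allBut-true {u = u} {p} {a} a∈ | allBut-false {u = u} {p} {b} b∉
      ... | a≢u , a≢p | inj₁ refl = others (u , a , incoming) a≢u (a≢p ∘ cong nbr) (≢τ₀ ∘ cong (arc u))
      ... | a≢u , a≢p | inj₂ refl = into-p≤0 a a≢p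

  module _ {u p d} (th : Thin u (u , p , incoming) (u , d , incoming)) where
    open Thin th

    no-thin-terminal-with-two-in-arcs : (∀ c → c ≢ p → x u c p ≤ 0ℚ) → (∀ b → b ≢ u → b ≢ p → x u p b ≤ 0ℚ) → ⊥
    no-thin-terminal-with-two-in-arcs into-p≤0 out-of-p≤0
      with terminal⇒partner (positive⇒root-terminal u p u nbr₁≢u (½-positive value₁))
    ... | P , t , partner with t ≟ p
    ...   | no t≢p   = no-thin-terminal-beside-in-neighbour th partner t≢p into-p≤0
    ...   | yes refl = light-star₁-impossible partner ⁅ p ⁆ (==-≢ (nbr₁≢u ∘ sym)) (==-refl p) (u , p , u)
          (≤-reflexive value₁) root-u (λ r b _ b≢u _ → others (r , b , outgoing) b≢u (λ ()) (λ ()))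
      where
      root-u : ∀ a b → ⁅ p ⁆ a ≡ true → ⁅ p ⁆ b ≡ false → (u , a , b) ≢ (u , p , u) → x u a b ≤ 0ℚ
      root-u a b a∈ b∉ ≢τ₀ with ==⇒≡ {a = a} {p} a∈ | b ≟ u
      ... | refl | yes refl = ⊥-elim (≢τ₀ refl)
      ... | refl | no b≢u   = out-of-p≤0 b b≢u (==⇒≢ b∉)

  module _ {P v t w eT} (thv : Thin v eT (w , w , outgoing)) (partner : Partner P v t) (t≢w : t ≢ w) where
    open Thin thv

    -- root w uses the cut V ∖ {w, v} and root v the cut V ∖ {v}
    no-thin-terminal-with-rooted-out-neighbour : ThinWith w (w , v , incoming) → proj₁ eT ≢ w → ⊥
    no-thin-terminal-with-rooted-out-neighbour ((r′ , c′ , incoming) , thw) root≢w with refl ← incoming-root (thin-swap thw) =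
      no-thin-terminal-with-two-in-arcs thw (λ c c≢v → incoming-vanish thv w c nbr₂≢u c≢v)
        (λ b b≢w b≢v → others (w , b , outgoing) b≢v (root≢w ∘ sym ∘ cong proj₁) (b≢w ∘ cong nbr))
    no-thin-terminal-with-rooted-out-neighbour ((r′ , c′ , outgoing) , thw) _ =
      light-star₂-impossible partner (allBut v v) (allBut-excludes v v) (allBut-≢ t≢v t≢v) w t≢w
        (arc v eT) (≤-reflexive value₁) root-v root-w other-roots
      where
      t≢v = partner-≢ partner
      root-v : ∀ a b → allBut v v a ≡ true → allBut v v b ≡ false → (v , a , b) ≢ arc v eT → x v a b ≤ 0ℚ
      root-v a b a∈ b∉ ≢τ₀ with refl ← reduce (allBut-false {u = v} {v} {b} b∉) =
        others (v , a , incoming) (proj₁ (allBut-true a∈)) (≢τ₀ ∘ cong (arc v)) (λ ())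
      root-w : w ≢ v → ∀ a b → a ≢ w → a ≢ v → b ≡ w ⊎ b ≡ v → x w a b ≤ 0ℚ
      root-w w≢v a b a≢w a≢v (inj₁ refl) = Thin.others thw (w , a , incoming) a≢w (a≢v ∘ cong nbr) (λ ())
      root-w w≢v a b a≢w a≢v (inj₂ refl) = incoming-vanish thv w a w≢v a≢v
      other-roots : ∀ r b → r ≢ v → r ≢ w → b ≢ v → (r , v , b) ≢ arc v eT → x r v b ≤ 0ℚ
      other-roots r b _ r≢w b≢v ≢τ₀ = others (r , b , outgoing) b≢v (≢τ₀ ∘ cong (arc v)) (r≢w ∘ cong proj₁)

  module _ {v a b} (th : Thin v (v , a , incoming) (v , b , incoming)) where
    open Thin th

    no-thin-vertex-with-two-in-arcs : ThinWith a (v , v , outgoing) → ThinWith b (v , v , outgoing) → ⊥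
    no-thin-vertex-with-two-in-arcs (_ , tha) (_ , thb)
      with terminal⇒partner (positive⇒root-terminal v a v nbr₁≢u (½-positive value₁))
    ... | P , t , partner with t ≟ b
    ...   | no t≢b   = no-thin-terminal-beside-in-neighbour (thin-swap th) partner t≢b
                         (λ c c≢b → incoming-vanish thb v c (nbr₂≢u ∘ sym) c≢b)
    ...   | yes refl = no-thin-terminal-beside-in-neighbour th partner nbr₂≢nbr₁
                         (λ c c≢a → incoming-vanish tha v c (nbr₁≢u ∘ sym) c≢a)

  module _ {v a b} (th : Thin v (v , a , incoming) (b , b , outgoing)) where
    open Thin th

    no-thin-vertex-with-in-and-out-arc : ThinWith a (v , v , outgoing) → ThinWith b (b , v , incoming) → ⊥
    no-thin-vertex-with-in-and-out-arc (_ , tha) thb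
      with terminal⇒partner (positive⇒root-terminal v a v nbr₁≢u (½-positive value₁))
    ... | P , t , partner with t ≟ a
    ...   | no t≢a   = no-thin-terminal-beside-in-neighbour th partner t≢a
                         (λ c c≢a → incoming-vanish tha v c (nbr₁≢u ∘ sym) c≢a)
    ...   | yes refl = no-thin-terminal-with-rooted-out-neighbour th partner (nbr₂≢nbr₁ ∘ sym) thb (nbr₂≢u ∘ sym)

  module _ {v a b} (th : Thin v (a , a , outgoing) (b , b , outgoing)) where
    open Thin th

    no-thin-vertex-with-two-out-arcs : ThinWith a (a , v , incoming) → ThinWith b (b , v , incoming) → ⊥
    no-thin-vertex-with-two-out-arcs tha thb with terminal? v
    ... | no ¬terminal = no-nonterminal-source a v a nbr₁≢u (nbr₁≢u ∘ sym) (≤-reflexive (sym value₁))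
                           (λ c c≢v → incoming-vanish th a c nbr₁≢u c≢v) ¬terminal
    ... | yes terminal with terminal⇒partner terminal
    ...   | P , t , partner with t ≟ a
    ...     | no t≢a   = no-thin-terminal-with-rooted-out-neighbour (thin-swap th) partner t≢a tha nbr₂≢nbr₁
    ...     | yes refl = no-thin-terminal-with-rooted-out-neighbour th partner (nbr₂≢nbr₁ ∘ sym) thb (nbr₂≢nbr₁ ∘ sym)

  mirror : Fin n → Entry → Entry
  mirror v (r , c , d) = r , v , flip d

  value-mirror : ∀ v e → value (nbr e) (mirror v e) ≡ value v e
  value-mirror v (r , c , outgoing) = refl
  value-mirror v (r , c , incoming) = refl

  -- an in-arc is rooted at its head, so an out-arc of v is rooted at its (thin) head
  no-thin-vertex-with-thin-neighbours : ∀ {v e₁ e₂} → Thin v e₁ e₂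
    → ThinWith (nbr e₁) (mirror v e₁) → ThinWith (nbr e₂) (mirror v e₂) → ⊥
  no-thin-vertex-with-thin-neighbours {e₁ = r₁ , a , incoming} {r₂ , b , incoming} th tha thb
    with refl ← incoming-root th | refl ← incoming-root (thin-swap th) =
    no-thin-vertex-with-two-in-arcs th tha thb
  no-thin-vertex-with-thin-neighbours {e₁ = r₁ , a , incoming} {r₂ , b , outgoing} th tha thb
    with refl ← incoming-root th | refl ← incoming-root (proj₂ thb) =
    no-thin-vertex-with-in-and-out-arc th tha thb
  no-thin-vertex-with-thin-neighbours {e₁ = r₁ , a , outgoing} {r₂ , b , incoming} th tha thb
    with refl ← incoming-root (proj₂ tha) | refl ← incoming-root (thin-swap th) =
    no-thin-vertex-with-in-and-out-arc (thin-swap th) thb tha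
  no-thin-vertex-with-thin-neighbours {e₁ = r₁ , a , outgoing} {r₂ , b , outgoing} th tha thb
    with refl ← incoming-root (proj₂ tha) | refl ← incoming-root (proj₂ thb) =
    no-thin-vertex-with-two-out-arcs th tha thb

  no-thin-neighbourhood : ∀ v → SupportVertex x v → (∀ w → v ≢ w → mult x v w < 2ℚ) → deg x v < 3ℚ
    → (∀ w → Adjacent x v w → deg x w < 3ℚ) → ⊥
  no-thin-neighbourhood v (w , v≢w , 0<m) mult<2 deg<3 nbr-deg<3
    with positive-mult⇒entry v w (v≢w ∘ sym) 0<m
  ... | e₁ , pos₁ , refl with single-or-thin v e₁ pos₁ (mult<2 _ v≢w) deg<3
  ...   | inj₁ single    = no-single-entry e₁ single
  ...   | inj₂ (e₂ , th) =
    no-thin-vertex-with-thin-neighbours th (neighbour-thin e₁ nbr₁≢u value₁) (neighbour-thin e₂ nbr₂≢u value₂)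
    where
    open Thin th
    neighbour-thin : ∀ e → nbr e ≢ v → value v e ≡ ½ → ThinWith (nbr e) (mirror v e)
    neighbour-thin e c≢v v≡½ with single-or-thin (nbr e) (mirror v e) positive m<2 (nbr-deg<3 (nbr e) adjacent)
      where
      positive : Positive (nbr e) (mirror v e)
      positive = c≢v ∘ sym , subst (0ℚ <_) (sym (value-mirror v e)) (½-positive v≡½)
      m<2 : mult x (nbr e) v < 2ℚ
      m<2 = subst (_< 2ℚ) (mult-sym v (nbr e)) (mult<2 (nbr e) (c≢v ∘ sym))
      adjacent : Adjacent x v (nbr e)
      adjacent = c≢v ∘ sym , <-≤-trans (<-trans 0<½ ½<1) (½≤value⇒1≤mult v e c≢v (≤-reflexive (sym v≡½)))
    ... | inj₁ single = ⊥-elim (no-single-entry (mirror v e) single)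
    ... | inj₂ thin   = thin

lemma11 : ∀ {n k} (I : Instance n k) (x : XVar n) (z : ZVar n k)
    → Feasible I x z → HalfIntegral x z → FullyReduced I x z
    → ∀ v → SupportVertex x v
    → ((∃[ w ] (v ≢ w × 2ℚ ≤ mult x v w))
        ⊎ (HighDegree x v ⊎ (∃[ w ] (Adjacent x v w × HighDegree x w))))
      × 2ℚ ≤ deg x v
lemma11 I x z feasible half reduced v support = parallel-or-high , degree≥2 v support
  where
  open Solution I x z feasible half reduced
  parallel-or-high : (∃[ w ] (v ≢ w × 2ℚ ≤ mult x v w)) ⊎ (HighDegree x v ⊎ (∃[ w ] (Adjacent x v w × HighDegree x w)))
  parallel-or-high with any? (λ w → ¬? (v ≟ w) ×-dec (2ℚ ≤? mult x v w)) | 3ℚ ≤? deg x v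
                      | any? (λ w → (¬? (v ≟ w) ×-dec (0ℚ <? mult x v w)) ×-dec (3ℚ ≤? deg x w))
  ... | yes parallel | _        | _           = inj₁ parallel
  ... | no _         | yes high | _           = inj₂ (inj₁ high)
  ... | no _         | no _     | yes highNbr = inj₂ (inj₂ highNbr)
  ... | no ¬parallel | no ¬high | no ¬highNbr = ⊥-elim (no-thin-neighbourhood v support
        (λ w v≢w → ≰⇒> (λ 2≤m → ¬parallel (w , v≢w , 2≤m))) (≰⇒> ¬high)
        (λ w adj → ≰⇒> (λ 3≤d → ¬highNbr (w , adj , 3≤d))))
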